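{- Let $t(n)=(-1)^{s_2(n)}$ ($s_2(n)$ the binary digit sum of $n$) and $T(n;x)=\sum_{m=0}^{n-1}t(m)x^m$. Let $\omega$ be a root of unity whose exact order is $r_0=p^{\alpha}$, where $p$ is an odd prime and $\alpha\ge 1$, and let $s_0$ be the multiplicative order of $2$ modulo $r_0$. Let $\varphi$ denote Euler's totient function. Then: (i) $T(2^{s_0};\omega)\in\mathbb{Z}$ if and only if $s_0=\varphi(r_0)$, and in this case $T(2^{s_0};\omega)=p$; (ii) if $s_0=\varphi(r_0)/2$ is odd, then $\{T(2^{s_0};\omega),\,T(2^{s_0};\omega^{ -1})\}=\{i\sqrt p,\,-i\sqrt p\}$.
   Context: $\{t(n)\}$ is the $\pm1$-valued Thue--Morse sequence. The exact order $r_0$ of $\omega$ is the least $r_0\ge1$ with $\omega^{r_0}=1$. -}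

module Defs where

open import Level using (Level)
open import Algebra.Bundles using (CommutativeRing)
import Algebra.Bundles
import Algebra.Definitions.RawSemiring as RS
open import Data.Nat as ℕ using (ℕ; zero; suc; _%_; _/_)
open import Data.Integer as ℤ using (ℤ; +_; -[1+_])
open import Data.List using (List; length; filter; map; upTo)
open import Data.Nat.Coprimality using (coprime?)
open import Data.Nat.Divisibility using (_∣_)
open import Data.Product using (_×_)
open import Data.Sum using (_⊎_)
open import Relation.Nullary using (¬_)

-- Binary digit sum s₂(n), computed with fuel n (n / 2 < n, so fuel n
-- always suffices).

digitSum₂-fuel : ℕ → ℕ → ℕ
digitSum₂-fuel zero    n = 0
digitSum₂-fuel (suc f) n = n % 2 ℕ.+ digitSum₂-fuel f (n / 2)

s₂ : ℕ → ℕ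
s₂ n = digitSum₂-fuel n n

φ : ℕ → ℕ
φ n = length (filter (λ k → coprime? k n) (map suc (upTo n)))

IsMultOrderOf2Mod : ℕ → ℕ → Set
IsMultOrderOf2Mod s r =
  1 ℕ.≤ s × r ∣ (2 ℕ.^ s ℕ.∸ 1) ×
  (∀ k → 1 ℕ.≤ k → k ℕ.< s → ¬ (r ∣ (2 ℕ.^ k ℕ.∸ 1)))

module _ {c ℓ : Level} (R : CommutativeRing c ℓ) where
  open CommutativeRing R
  open RS (Algebra.Bundles.Semiring.rawSemiring semiring) renaming (_^_ to _^ᴿ_; _×_ to _·ᴿ_) using ()

  pow : Carrier → ℕ → Carrier
  pow x n = x ^ᴿ n

  fromℤ : ℤ → Carrier
  fromℤ (+ n)    = n ·ᴿ 1#
  fromℤ -[1+ n ] = - (suc n ·ᴿ 1#)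

  CharZero : Set ℓ
  CharZero = ∀ n → ¬ (suc n ·ᴿ 1# ≈ 0#)

  NoZeroDivisors : Set (c Level.⊔ ℓ)
  NoZeroDivisors = ∀ x y → x * y ≈ 0# → x ≈ 0# ⊎ y ≈ 0#

  HasExactOrder : Carrier → ℕ → Set ℓ
  HasExactOrder ω r =
    1 ℕ.≤ r Data.Product.× pow ω r ≈ 1# Data.Product.×
    (∀ k → 1 ℕ.≤ k → k ℕ.< r → ¬ (pow ω k ≈ 1#))

  t : ℕ → Carrier
  t m = pow (- 1#) (s₂ m)

  T : ℕ → Carrier → Carrier
  T zero    x = 0#
  T (suc n) x = T n x + t n * pow x n

-- By the digit-sum recursion, T(2^s; x) = ∏_{j<s} (1 - x^(2^j)). For j < s₀ the residues 2^j mod r are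
-- distinct units mod r, and for odd s₀ so are their negatives, with no overlap. The product of 1 - ωᵏ over
-- all units k mod r equals p (from ∏_{0<k<n} (1 - ζᵏ) = n for ζ of order n, read off the elementary
-- symmetric functions of the n-th roots of unity). Hence T(2^s₀; ω) = p when s₀ = φ(r), and
-- T(2^s₀; ω) T(2^s₀; ω⁻¹) = p with T(2^s₀; ω⁻¹) = -T(2^s₀; ω) when 2 s₀ = φ(r) and s₀ is odd.
-- If s₀ < φ(r) and T = z ∈ ℤ, then p = z (1 - ωᵏ) ⋯ for some unit k not of the form 2^j, and 1 - ω divides
-- both z and 1 - ωᵏ in ℤ[ω]. Cancelling p (if p ∣ z) or using Bézout (otherwise) makes 1 - ω a unit of ℤ[ω];
-- then so is every 1 - ωᵏ with k a unit, hence so is p, which the determinant trick rules out because ℤ[ω]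
-- is a finitely generated ℤ-module.

module Submission where

open import Defs
open import Level using (0ℓ; _⊔_)
open import Algebra.Bundles using (CommutativeRing)
import Algebra.Properties.CommutativeSemiring.Exp as CommutativeSemiringExp
import Algebra.Properties.Monoid.Mult.TCOptimised as TCOptimised
import Algebra.Properties.Ring as RingProperties
import Algebra.Properties.Semiring.Exp as SemiringExp
import Algebra.Properties.Semiring.Mult as SemiringMult
import Algebra.Solver.Ring as RingSolver
open import Algebra.Solver.Ring.AlmostCommutativeRing using (fromCommutativeRing; _-Raw-AlmostCommutative⟶_)
open import Data.Empty using (⊥; ⊥-elim)
open import Data.Integer as ℤ using (ℤ; +_)
import Data.Integer.Divisibility.Signed as ℤ∣
import Data.Integer.Properties as ℤₚ
open import Data.Integer.Tactic.RingSolver using (solve-∀)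
open import Data.List as List using (List; []; _∷_; _++_; _∷ʳ_; length; filter; applyUpTo; upTo)
open import Data.List.Membership.Propositional using (_∈_)
import Data.List.Membership.Propositional.Properties as ∈ₚ
import Data.List.Properties as Listₚ
import Data.List.Relation.Binary.Permutation.Propositional as ↭
open import Data.List.Relation.Binary.Permutation.Propositional using (_↭_)
open import Data.List.Relation.Binary.Permutation.Propositional.Properties using (↭-length; ∈-resp-↭)
open import Data.List.Relation.Unary.All as All using (All; []; _∷_)
import Data.List.Relation.Unary.All.Properties as Allₚ
open import Data.List.Relation.Unary.AllPairs using ([]; _∷_)
import Data.List.Relation.Unary.AllPairs.Properties as AllPairsₚ
open import Data.List.Relation.Unary.Any using (here; there; _─_)
open import Data.List.Relation.Unary.Unique.Propositional using (Unique)
import Data.List.Relation.Unary.Unique.Propositional.Properties as Uniqueₚ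
open import Data.Maybe using (Maybe; just; nothing)
open import Data.Nat as ℕ using (ℕ; zero; suc; z≤n; s≤s; _≤_; _<_; _^_; _%_; _/_; _∸_; NonZero)
open import Data.Nat.Coprimality as Coprimality using (Coprime; coprime?)
open import Data.Nat.Divisibility as ℕ∣ using (divides; _∣?_)
import Data.Nat.DivMod as ℕₚ
open import Data.Nat.GCD using (module Bézout)
open import Data.Nat.Primality using (Prime; prime⇒irreducible; prime⇒nonTrivial; prime⇒nonZero; euclidsLemma)
import Data.Nat.Properties as ℕₚ
open import Data.Product using (_×_; _,_; proj₁; proj₂; ∃-syntax; map₂)
open import Data.Sign as Sign using (Sign)
open import Data.Sum as Sum using (_⊎_; inj₁; inj₂)
open import Function using (_∘_)
open import Function.Bundles using (_⇔_; mk⇔; Equivalence)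
open import Relation.Binary.Bundles using (Setoid)
open import Relation.Binary.Definitions using (tri<; tri≈; tri>)
open import Relation.Binary.PropositionalEquality as ≡ using (_≡_; _≢_)
open import Relation.Nullary using (¬_; yes; no; ¬?)
open import Relation.Unary using (Pred; Decidable)

module BinaryDigitSum where
  open ≡ using (refl; sym; trans; cong; cong₂; subst; module ≡-Reasoning)
  open import Data.Nat using (_+_; _*_)

  digitSum₂-fuel-0 : ∀ f → digitSum₂-fuel f 0 ≡ 0
  digitSum₂-fuel-0 zero    = refl
  digitSum₂-fuel-0 (suc f) = digitSum₂-fuel-0 f

  private
    n/2≤f : ∀ n f → n ≤ suc f → n / 2 ≤ f
    n/2≤f zero    f _  = z≤n
    n/2≤f (suc k) f le = ℕₚ.≤-pred (ℕₚ.≤-trans (ℕₚ.m/n<m (suc k) 2 (s≤s (s≤s z≤n))) le)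

  digitSum₂-fuel-stable : ∀ f g n → n ≤ f → n ≤ g → digitSum₂-fuel f n ≡ digitSum₂-fuel g n
  digitSum₂-fuel-stable zero    g       .zero z≤n _   = sym (digitSum₂-fuel-0 g)
  digitSum₂-fuel-stable (suc f) zero    .zero _   z≤n = digitSum₂-fuel-0 (suc f)
  digitSum₂-fuel-stable (suc f) (suc g) n     le₁ le₂ =
    cong (λ x → n % 2 + x) (digitSum₂-fuel-stable f g (n / 2) (n/2≤f n f le₁) (n/2≤f n g le₂))

  s₂-unfold : ∀ n → s₂ n ≡ n % 2 + s₂ (n / 2)
  s₂-unfold zero    = refl
  s₂-unfold (suc k) = cong (λ x → suc k % 2 + x)
    (digitSum₂-fuel-stable k (suc k / 2) (suc k / 2) (n/2≤f (suc k) k ℕₚ.≤-refl) ℕₚ.≤-refl)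

  s₂[m+2^s]≡1+s₂[m] : ∀ s m → m < 2 ^ s → s₂ (m + 2 ^ s) ≡ suc (s₂ m)
  s₂[m+2^s]≡1+s₂[m] zero    zero    _          = refl
  s₂[m+2^s]≡1+s₂[m] zero    (suc m) (s≤s ())
  s₂[m+2^s]≡1+s₂[m] (suc s) m       m<2^[1+s] = begin
    s₂ (m + 2 * 2 ^ s)                               ≡⟨ s₂-unfold (m + 2 * 2 ^ s) ⟩
    (m + 2 * 2 ^ s) % 2 + s₂ ((m + 2 * 2 ^ s) / 2)   ≡⟨ cong₂ (λ a b → a + s₂ b) mod-eq div-eq ⟩
    m % 2 + s₂ (m / 2 + 2 ^ s)                       ≡⟨ cong (λ x → m % 2 + x) (s₂[m+2^s]≡1+s₂[m] s (m / 2) m/2<2^s) ⟩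
    m % 2 + suc (s₂ (m / 2))                         ≡⟨ ℕₚ.+-suc (m % 2) _ ⟩
    suc (m % 2 + s₂ (m / 2))                         ≡⟨ cong suc (s₂-unfold m) ⟨
    suc (s₂ m)                                       ∎
    where
    open ≡-Reasoning
    2*2^s≡2^s*2 : 2 * 2 ^ s ≡ 2 ^ s * 2
    2*2^s≡2^s*2 = ℕₚ.*-comm 2 (2 ^ s)
    mod-eq : (m + 2 * 2 ^ s) % 2 ≡ m % 2
    mod-eq = trans (cong (λ x → (m + x) % 2) 2*2^s≡2^s*2) (ℕₚ.[m+kn]%n≡m%n m (2 ^ s) 2)
    div-eq : (m + 2 * 2 ^ s) / 2 ≡ m / 2 + 2 ^ s
    div-eq = trans (ℕₚ.+-distrib-/-∣ʳ m (divides (2 ^ s) 2*2^s≡2^s*2))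
                   (cong (λ x → m / 2 + x) (trans (cong (_/ 2) 2*2^s≡2^s*2) (ℕₚ.m*n/n≡m (2 ^ s) 2)))
    m/2<2^s : m / 2 < 2 ^ s
    m/2<2^s = ℕₚ.m<n*o⇒m/o<n (subst (m <_) 2*2^s≡2^s*2 m<2^[1+s])

module Intervals where
  open ≡ using (refl; sym; trans; cong; cong₂; subst; module ≡-Reasoning)
  open import Data.Nat using (_+_; _*_)

  applyUpTo-+ : ∀ {a} {A : Set a} (f : ℕ → A) m n →
                applyUpTo f (m + n) ≡ applyUpTo f m ++ applyUpTo (λ i → f (m + i)) n
  applyUpTo-+ f zero    n = refl
  applyUpTo-+ f (suc m) n = cong (f 0 ∷_) (applyUpTo-+ (f ∘ suc) m n)

  applyUpTo-pred : ∀ {a} {A : Set a} (f : ℕ → A) n .{{_ : NonZero n}} →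
                   applyUpTo f n ≡ applyUpTo f (ℕ.pred n) ∷ʳ f (ℕ.pred n)
  applyUpTo-pred f (suc n) = sym (Listₚ.applyUpTo-∷ʳ f n)

  filter-∣-applyUpTo : ∀ q .{{_ : NonZero q}} M →
                       filter (q ∣?_) (applyUpTo suc (q * M)) ≡ applyUpTo (λ j → q * suc j) M
  filter-∣-applyUpTo (suc q) zero    = cong (λ n → filter (suc q ∣?_) (applyUpTo suc n)) (ℕₚ.*-zeroʳ q)
  filter-∣-applyUpTo (suc q) (suc M) = begin
    filter (Q ∣?_) (applyUpTo suc (Q * suc M))
      ≡⟨ cong (λ n → filter (Q ∣?_) (applyUpTo suc n)) (trans (ℕₚ.*-suc Q M) (ℕₚ.+-comm Q (Q * M))) ⟩
    filter (Q ∣?_) (applyUpTo suc (Q * M + Q))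
      ≡⟨ cong (filter (Q ∣?_)) (applyUpTo-+ suc (Q * M) Q) ⟩
    filter (Q ∣?_) (applyUpTo suc (Q * M) ++ applyUpTo block Q)
      ≡⟨ Listₚ.filter-++ (Q ∣?_) (applyUpTo suc (Q * M)) (applyUpTo block Q) ⟩
    filter (Q ∣?_) (applyUpTo suc (Q * M)) ++ filter (Q ∣?_) (applyUpTo block Q)
      ≡⟨ cong₂ _++_ (filter-∣-applyUpTo Q M) filter-block ⟩
    applyUpTo (λ j → Q * suc j) M ∷ʳ Q * suc M
      ≡⟨ Listₚ.applyUpTo-∷ʳ (λ j → Q * suc j) M ⟩
    applyUpTo (λ j → Q * suc j) (suc M) ∎
    where
    open ≡-Reasoning
    Q : ℕ
    Q = suc q
    block : ℕ → ℕ
    block i = suc (Q * M + i)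
    last≡ : block q ≡ Q * suc M
    last≡ = trans (sym (ℕₚ.+-suc (Q * M) q)) (trans (ℕₚ.+-comm (Q * M) Q) (sym (ℕₚ.*-suc Q M)))
    block-∤ : ∀ {i} → i < q → ¬ Q ℕ∣.∣ block i
    block-∤ {i} i<q Q∣ = ℕₚ.<⇒≱ (s≤s i<q)
      (ℕ∣.∣⇒≤ (ℕ∣.∣m+n∣m⇒∣n (subst (Q ℕ∣.∣_) (sym (ℕₚ.+-suc (Q * M) i)) Q∣) (ℕ∣.m∣m*n M)))
    filter-block : filter (Q ∣?_) (applyUpTo block Q) ≡ Q * suc M ∷ []
    filter-block = begin
      filter (Q ∣?_) (applyUpTo block Q)
        ≡⟨ cong (filter (Q ∣?_)) (Listₚ.applyUpTo-∷ʳ block q) ⟨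
      filter (Q ∣?_) (applyUpTo block q ∷ʳ block q)
        ≡⟨ Listₚ.filter-++ (Q ∣?_) (applyUpTo block q) _ ⟩
      filter (Q ∣?_) (applyUpTo block q) ++ filter (Q ∣?_) (block q ∷ [])
        ≡⟨ cong₂ _++_ (Listₚ.filter-none (Q ∣?_) (Allₚ.applyUpTo⁺₁ block q block-∤))
                      (cong (λ n → filter (Q ∣?_) (n ∷ [])) last≡) ⟩
      filter (Q ∣?_) (Q * suc M ∷ [])
        ≡⟨ Listₚ.filter-accept (Q ∣?_) (ℕ∣.m∣m*n (suc M)) ⟩
      Q * suc M ∷ [] ∎

coprime-* : ∀ {k a b} → Coprime k a → Coprime k b → Coprime k (a ℕ.* b)
coprime-* {a = a} k⊥a k⊥b {d} (d∣k , d∣ab) = k⊥b (d∣k , Coprimality.coprime-divisor d⊥a d∣ab)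
  where
  d⊥a : Coprime d a
  d⊥a (e∣d , e∣a) = k⊥a (ℕ∣.∣-trans e∣d d∣k , e∣a)

module PrimePowers {p : ℕ} (p-prime : Prime p) where
  open ≡ using (refl; sym)

  1<p : 1 < p
  1<p = ℕ.nonTrivial⇒n>1 p {{prime⇒nonTrivial p-prime}}

  ∤⇒coprime : ∀ {k} → ¬ p ℕ∣.∣ k → Coprime k p
  ∤⇒coprime p∤k {d} (d∣k , d∣p) with prime⇒irreducible p-prime d∣p
  ... | inj₁ d≡1 = d≡1
  ... | inj₂ refl = ⊥-elim (p∤k d∣k)

  ∤⇒coprime-^ : ∀ {k} → ¬ p ℕ∣.∣ k → ∀ n → Coprime k (p ^ n)
  ∤⇒coprime-^ p∤k zero    (_ , d∣1) = ℕ∣.∣1⇒≡1 d∣1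
  ∤⇒coprime-^ p∤k (suc n) = coprime-* (∤⇒coprime p∤k) (∤⇒coprime-^ p∤k n)

  ∣⇒¬coprime-^ : ∀ {k} n → p ℕ∣.∣ k → ¬ Coprime k (p ^ suc n)
  ∣⇒¬coprime-^ n p∣k k⊥p^n = ℕₚ.<⇒≢ 1<p (sym (k⊥p^n (p∣k , ℕ∣.m∣m*n (p ^ n))))

  ∣2^⇒≡2 : ∀ j → p ℕ∣.∣ 2 ^ j → p ≡ 2
  ∣2^⇒≡2 zero    p∣1 = ⊥-elim (ℕₚ.<⇒≢ 1<p (sym (ℕ∣.∣1⇒≡1 p∣1)))
  ∣2^⇒≡2 (suc j) p∣2^[1+j] with euclidsLemma 2 (2 ^ j) p-prime p∣2^[1+j]
  ... | inj₁ p∣2 = ℕₚ.≤-antisym (ℕ∣.∣⇒≤ p∣2) 1<p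
  ... | inj₂ p∣2^j = ∣2^⇒≡2 j p∣2^j

module Congruence (r : ℕ) where
  open ≡ using (refl; sym; trans; cong; subst; module ≡-Reasoning)
  open import Data.Integer using (_+_; _*_; -_; _-_)

  infix 4 _≡ᵣ_
  record _≡ᵣ_ (x y : ℤ) : Set where
    constructor mk
    field r∣x-y : + r ℤ∣.∣ (x - y)
  open _≡ᵣ_

  ≡ᵣ-reflexive : ∀ {x y} → x ≡ y → x ≡ᵣ y
  ≡ᵣ-reflexive {x} refl = mk (ℤ∣.divides (+ 0) (ℤₚ.+-inverseʳ x))

  ≡ᵣ-sym : ∀ {x y} → x ≡ᵣ y → y ≡ᵣ x
  ≡ᵣ-sym {x} {y} x≡y = mk (subst (+ r ℤ∣.∣_) (eq x y) (ℤ∣.∣m⇒∣-m (r∣x-y x≡y)))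
    where
    eq : ∀ x y → - (x - y) ≡ y - x
    eq = solve-∀

  ≡ᵣ-trans : ∀ {x y z} → x ≡ᵣ y → y ≡ᵣ z → x ≡ᵣ z
  ≡ᵣ-trans {x} {y} {z} x≡y y≡z = mk (subst (+ r ℤ∣.∣_) (eq x y z) (ℤ∣.∣m∣n⇒∣m+n (r∣x-y x≡y) (r∣x-y y≡z)))
    where
    eq : ∀ x y z → (x - y) + (y - z) ≡ x - z
    eq = solve-∀

  ≡ᵣ-setoid : Setoid 0ℓ 0ℓ
  ≡ᵣ-setoid = record
    { Carrier = ℤ ; _≈_ = _≡ᵣ_
    ; isEquivalence = record { refl = ≡ᵣ-reflexive refl ; sym = ≡ᵣ-sym ; trans = ≡ᵣ-trans } }

  ≡ᵣ-*-cong : ∀ {x x′ y y′} → x ≡ᵣ x′ → y ≡ᵣ y′ → x * y ≡ᵣ x′ * y′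
  ≡ᵣ-*-cong {x} {x′} {y} {y′} x≡x′ y≡y′ = mk (subst (+ r ℤ∣.∣_) (eq x x′ y y′)
    (ℤ∣.∣m∣n⇒∣m+n (ℤ∣.∣m⇒∣m*n y (r∣x-y x≡x′)) (ℤ∣.∣n⇒∣m*n x′ (r∣x-y y≡y′))))
    where
    eq : ∀ x x′ y y′ → (x - x′) * y + x′ * (y - y′) ≡ x * y - x′ * y′
    eq = solve-∀

  ≡ᵣ-*-congˡ : ∀ x {y y′} → y ≡ᵣ y′ → x * y ≡ᵣ x * y′
  ≡ᵣ-*-congˡ x = ≡ᵣ-*-cong (≡ᵣ-reflexive {x} refl)

  ≡ᵣ-*-congʳ : ∀ z {x y} → x ≡ᵣ y → x * z ≡ᵣ y * z
  ≡ᵣ-*-congʳ z x≡y = ≡ᵣ-*-cong x≡y (≡ᵣ-reflexive {z} refl)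

  ≡ᵣ-neg-cong : ∀ {x y} → x ≡ᵣ y → - x ≡ᵣ - y
  ≡ᵣ-neg-cong {x} {y} x≡y = mk (subst (+ r ℤ∣.∣_) (eq x y) (ℤ∣.∣m⇒∣-m (r∣x-y x≡y)))
    where
    eq : ∀ x y → - (x - y) ≡ - x - - y
    eq = solve-∀

  m≡ᵣm%r : ∀ m .{{_ : NonZero r}} → + m ≡ᵣ + (m % r)
  m≡ᵣm%r m = mk (ℤ∣.divides (+ (m / r)) (begin
    + m - + (m % r)                           ≡⟨ cong (λ n → + n - + (m % r)) (ℕₚ.m≡m%n+[m/n]*n m r) ⟩
    + (m % r ℕ.+ m / r ℕ.* r) - + (m % r)     ≡⟨ cong (_- + (m % r)) (ℤₚ.pos-+ (m % r) (m / r ℕ.* r)) ⟩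
    (+ (m % r) + + (m / r ℕ.* r)) - + (m % r) ≡⟨ cong (λ z → (+ (m % r) + z) - + (m % r)) (ℤₚ.pos-* (m / r) r) ⟩
    (+ (m % r) + + (m / r) * + r) - + (m % r) ≡⟨ eq (+ (m % r)) (+ (m / r)) (+ r) ⟩
    + (m / r) * + r                           ∎))
    where
    open ≡-Reasoning
    eq : ∀ a b c → (a + b * c) - a ≡ b * c
    eq = solve-∀

  r∸a≡ᵣ-a : ∀ {a} → a ≤ r → + (r ∸ a) ≡ᵣ - + a
  r∸a≡ᵣ-a {a} a≤r = mk (ℤ∣.divides (+ 1) (begin
    + (r ∸ a) - - + a    ≡⟨ cong (λ z → + (r ∸ a) + z) (ℤₚ.neg-involutive (+ a)) ⟩
    + (r ∸ a) + + a      ≡⟨ ℤₚ.pos-+ (r ∸ a) a ⟨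
    + (r ∸ a ℕ.+ a)      ≡⟨ cong +_ (ℕₚ.m∸n+n≡m a≤r) ⟩
    + r                  ≡⟨ ℤₚ.*-identityˡ (+ r) ⟨
    + 1 * + r            ∎))
    where open ≡-Reasoning

  ≡ᵣ1⇔∣∸1 : ∀ m → 1 ≤ m → + m ≡ᵣ + 1 ⇔ r ℕ∣.∣ m ∸ 1
  ≡ᵣ1⇔∣∸1 m 1≤m = mk⇔ (λ m≡1 → subst (r ℕ∣.∣_) ∣m-1∣≡m∸1 (ℤ∣.∣⇒∣ᵤ (r∣x-y m≡1)))
                      (λ r∣m∸1 → mk (ℤ∣.∣ᵤ⇒∣ (subst (r ℕ∣.∣_) (sym ∣m-1∣≡m∸1) r∣m∸1)))
    where
    ∣m-1∣≡m∸1 : ℤ.∣ + m - + 1 ∣ ≡ m ∸ 1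
    ∣m-1∣≡m∸1 = trans (cong ℤ.∣_∣ (ℤₚ.[+m]-[+n]≡m⊖n m 1)) (cong ℤ.∣_∣ (ℤₚ.⊖-≥ 1≤m))

module PowersOfTwoModulo (r s₀ : ℕ) (3≤r : 3 ≤ r) (s₀-order : IsMultOrderOf2Mod s₀ r) where
  open ≡ using (sym; trans; cong; subst)
  open import Data.Nat using (_+_)
  open import Data.Integer using (_*_; -_)
  open Congruence r
  open import Relation.Binary.Reasoning.Setoid ≡ᵣ-setoid

  two^ : ℕ → ℤ
  two^ k = + (2 ^ k)

  two^-+ : ∀ m n → two^ (m + n) ≡ two^ m * two^ n
  two^-+ m n = trans (cong +_ (ℕₚ.^-distribˡ-+-* 2 m n)) (ℤₚ.pos-* (2 ^ m) (2 ^ n))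

  two^s₀≡ᵣ1 : two^ s₀ ≡ᵣ + 1
  two^s₀≡ᵣ1 = Equivalence.from (≡ᵣ1⇔∣∸1 (2 ^ s₀) (ℕₚ.m^n>0 2 s₀)) (proj₁ (proj₂ s₀-order))

  two^≢ᵣ1 : ∀ {k} → 1 ≤ k → k < s₀ → ¬ two^ k ≡ᵣ + 1
  two^≢ᵣ1 {k} 1≤k k<s₀ 2^k≡1 =
    proj₂ (proj₂ s₀-order) k 1≤k k<s₀ (Equivalence.to (≡ᵣ1⇔∣∸1 (2 ^ k) (ℕₚ.m^n>0 2 k)) 2^k≡1)

  -- 2 ^ (s₀ ∸ i) is an inverse of 2 ^ i.
  two^-cancelˡ : ∀ {i x y} → i ≤ s₀ → two^ i * x ≡ᵣ two^ i * y → x ≡ᵣ y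
  two^-cancelˡ {i} {x} {y} i≤s₀ eq = begin
    x                    ≡⟨ ℤₚ.*-identityʳ x ⟨
    x * + 1              ≈⟨ ≡ᵣ-*-congˡ x two^s₀≡ᵣ1 ⟨
    x * two^ s₀          ≡⟨ reassoc x ⟩
    (two^ i * x) * u     ≈⟨ ≡ᵣ-*-congʳ u eq ⟩
    (two^ i * y) * u     ≡⟨ reassoc y ⟨
    y * two^ s₀          ≈⟨ ≡ᵣ-*-congˡ y two^s₀≡ᵣ1 ⟩
    y * + 1              ≡⟨ ℤₚ.*-identityʳ y ⟩
    y                    ∎
    where
    u : ℤ
    u = two^ (s₀ ∸ i)
    reassoc : ∀ z → z * two^ s₀ ≡ (two^ i * z) * u
    reassoc z = trans (cong (λ k → z * two^ k) (sym (ℕₚ.m+[n∸m]≡n i≤s₀)))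
               (trans (cong (z *_) (two^-+ i (s₀ ∸ i))) (eq′ z (two^ i) u))
      where
      eq′ : ∀ a b c → a * (b * c) ≡ (b * a) * c
      eq′ = solve-∀

  two^≡ᵣ1⇒≡s₀ : ∀ {e} → 1 ≤ e → e < s₀ + s₀ → two^ e ≡ᵣ + 1 → e ≡ s₀
  two^≡ᵣ1⇒≡s₀ {e} 1≤e e<2s₀ 2^e≡1 with ℕₚ.<-cmp e s₀
  ... | tri< e<s₀ _ _ = ⊥-elim (two^≢ᵣ1 1≤e e<s₀ 2^e≡1)
  ... | tri≈ _ e≡s₀ _ = e≡s₀
  ... | tri> _ _ s₀<e = ⊥-elim (two^≢ᵣ1 (ℕₚ.m<n⇒0<n∸m s₀<e) f<s₀ 2^f≡1)
    where
    f = e ∸ s₀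
    e≡s₀+f : e ≡ s₀ + f
    e≡s₀+f = sym (ℕₚ.m+[n∸m]≡n (ℕₚ.<⇒≤ s₀<e))
    f<s₀ : f < s₀
    f<s₀ = ℕₚ.+-cancelˡ-< s₀ f s₀ (subst (_< s₀ + s₀) e≡s₀+f e<2s₀)
    2^f≡1 : two^ f ≡ᵣ + 1
    2^f≡1 = two^-cancelˡ ℕₚ.≤-refl (begin
      two^ s₀ * two^ f  ≡⟨ two^-+ s₀ f ⟨
      two^ (s₀ + f)     ≡⟨ cong two^ e≡s₀+f ⟨
      two^ e            ≈⟨ 2^e≡1 ⟩
      + 1               ≈⟨ two^s₀≡ᵣ1 ⟨
      two^ s₀           ≡⟨ ℤₚ.*-identityʳ (two^ s₀) ⟨
      two^ s₀ * + 1     ∎)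

  two^-injective : ∀ {i j} → i < j → j < s₀ → ¬ two^ i ≡ᵣ two^ j
  two^-injective {i} {j} i<j j<s₀ 2^i≡2^j =
    two^≢ᵣ1 (ℕₚ.m<n⇒0<n∸m i<j) (ℕₚ.≤-<-trans (ℕₚ.m∸n≤m j i) j<s₀)
      (≡ᵣ-sym (two^-cancelˡ (ℕₚ.<⇒≤ (ℕₚ.<-trans i<j j<s₀)) (begin
      two^ i * + 1         ≡⟨ ℤₚ.*-identityʳ (two^ i) ⟩
      two^ i               ≈⟨ 2^i≡2^j ⟩
      two^ j               ≡⟨ cong two^ (ℕₚ.m+[n∸m]≡n (ℕₚ.<⇒≤ i<j)) ⟨
      two^ (i + (j ∸ i))   ≡⟨ two^-+ i (j ∸ i) ⟩
      two^ i * two^ (j ∸ i) ∎)))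

  -- For odd s₀, -1 is not a power of 2 modulo r: its square would be 1 at the even exponent 2 d.
  1≢ᵣ-two^ : ∀ {d} → d < s₀ → s₀ % 2 ≡ 1 → ¬ (+ 1 ≡ᵣ - two^ d)
  1≢ᵣ-two^ {zero}  _    _   1≡-1 = ℕₚ.<⇒≱ (ℕₚ.<-≤-trans (s≤s (s≤s (s≤s z≤n))) 3≤r)
                                           (ℕ∣.∣⇒≤ (ℤ∣.∣⇒∣ᵤ (_≡ᵣ_.r∣x-y 1≡-1)))
  1≢ᵣ-two^ {suc d} d<s₀ odd 1≡-2^d = ℕₚ.0≢1+n (trans (sym (even (suc d))) (trans (cong (_% 2) 2d≡s₀) odd))
    where
    even : ∀ n → (n + n) % 2 ≡ 0
    even n = trans (cong (λ m → (n + m) % 2) (sym (ℕₚ.+-identityʳ n))) (trans (cong (_% 2) (ℕₚ.*-comm 2 n)) (ℕₚ.m*n%n≡0 n 2))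
    2d≡s₀ : suc d + suc d ≡ s₀
    2d≡s₀ = two^≡ᵣ1⇒≡s₀ (s≤s z≤n) (ℕₚ.+-mono-< d<s₀ d<s₀) (begin
      two^ (suc d + suc d)                  ≡⟨ two^-+ (suc d) (suc d) ⟩
      two^ (suc d) * two^ (suc d)           ≡⟨ ℤₚ.neg-involutive _ ⟨
      - - (two^ (suc d) * two^ (suc d))     ≡⟨ cong -_ (ℤₚ.neg-distribʳ-* (two^ (suc d)) (two^ (suc d))) ⟩
      - (two^ (suc d) * - two^ (suc d))     ≡⟨ ℤₚ.neg-distribˡ-* (two^ (suc d)) (- two^ (suc d)) ⟩
      - two^ (suc d) * - two^ (suc d)       ≈⟨ ≡ᵣ-*-cong 1≡-2^d 1≡-2^d ⟨
      + 1 * + 1                             ∎)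

  private
    two^≢ᵣ-two^-≤ : ∀ {i j} → i ≤ j → j < s₀ → s₀ % 2 ≡ 1 → ¬ two^ i ≡ᵣ - two^ j
    two^≢ᵣ-two^-≤ {i} {j} i≤j j<s₀ odd eq = 1≢ᵣ-two^ (ℕₚ.≤-<-trans (ℕₚ.m∸n≤m j i) j<s₀) odd
      (two^-cancelˡ (ℕₚ.<⇒≤ (ℕₚ.≤-<-trans i≤j j<s₀)) (begin
        two^ i * + 1              ≡⟨ ℤₚ.*-identityʳ (two^ i) ⟩
        two^ i                    ≈⟨ eq ⟩
        - two^ j                  ≡⟨ cong (λ k → - two^ k) (ℕₚ.m+[n∸m]≡n i≤j) ⟨
        - two^ (i + (j ∸ i))      ≡⟨ cong -_ (two^-+ i (j ∸ i)) ⟩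
        - (two^ i * two^ (j ∸ i)) ≡⟨ ℤₚ.neg-distribʳ-* (two^ i) (two^ (j ∸ i)) ⟩
        two^ i * - two^ (j ∸ i)   ∎))

  two^≢ᵣ-two^ : ∀ {i j} → i < s₀ → j < s₀ → s₀ % 2 ≡ 1 → ¬ two^ i ≡ᵣ - two^ j
  two^≢ᵣ-two^ {i} {j} i<s₀ j<s₀ odd 2^i≡-2^j with ℕₚ.≤-total i j
  ... | inj₁ i≤j = two^≢ᵣ-two^-≤ i≤j j<s₀ odd 2^i≡-2^j
  ... | inj₂ j≤i = two^≢ᵣ-two^-≤ j≤i i<s₀ odd (begin
    two^ j         ≡⟨ ℤₚ.neg-involutive (two^ j) ⟨
    - - two^ j     ≈⟨ ≡ᵣ-neg-cong 2^i≡-2^j ⟨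
    - two^ i       ∎)

module DuplicateFree {a} {A : Set a} where
  open ≡ using (refl; sym)

  private variable
    x z : A
    xs ys : List A

  ─-↭ : (x∈xs : x ∈ xs) → xs ↭ x ∷ (xs ─ x∈xs)
  ─-↭ (here refl) = ↭.refl
  ─-↭ {x} {y ∷ xs} (there x∈xs) = ↭.trans (↭.prep y (─-↭ x∈xs)) (↭.swap y x ↭.refl)

  ∈-─⁻ : (x∈xs : x ∈ xs) → z ∈ (xs ─ x∈xs) → z ∈ xs
  ∈-─⁻ x∈xs z∈ = ∈-resp-↭ (↭.↭-sym (─-↭ x∈xs)) (there z∈)

  ∈-─⁺ : (x∈xs : x ∈ xs) → z ∈ xs → z ≢ x → z ∈ (xs ─ x∈xs)
  ∈-─⁺ (here refl) (here refl) z≢x = ⊥-elim (z≢x refl)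
  ∈-─⁺ (here refl) (there z∈) _   = z∈
  ∈-─⁺ {xs = _ ∷ _} (there x∈) (here refl) _   = here refl
  ∈-─⁺ {xs = _ ∷ _} (there x∈) (there z∈)  z≢x = there (∈-─⁺ x∈ z∈ z≢x)

  ─-unique : (x∈xs : x ∈ xs) → Unique xs → Unique (xs ─ x∈xs)
  ─-unique (here _) (_ ∷ u) = u
  ─-unique {xs = _ ∷ _} (there x∈) (y∉ ∷ u) = All.tabulate (All.lookup y∉ ∘ ∈-─⁻ x∈) ∷ ─-unique x∈ u

  unique-⊆⇒↭++ : Unique xs → Unique ys → (∀ {v} → v ∈ ys → v ∈ xs) → ∃[ zs ] xs ↭ ys ++ zs
  unique-⊆⇒↭++ {xs} _ [] _ = xs , ↭.refl
  unique-⊆⇒↭++ {xs} {y ∷ ys} uxs (y∉ys ∷ uys) ys⊆xs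
    = map₂ (λ xs─y↭ys++zs → ↭.trans (─-↭ y∈xs) (↭.prep y xs─y↭ys++zs))
           (unique-⊆⇒↭++ (─-unique y∈xs uxs) uys ys⊆xs─y)
    where
    y∈xs : y ∈ xs
    y∈xs = ys⊆xs (here refl)
    ys⊆xs─y : ∀ {v} → v ∈ ys → v ∈ (xs ─ y∈xs)
    ys⊆xs─y v∈ys = ∈-─⁺ y∈xs (ys⊆xs (there v∈ys)) (λ v≡y → All.lookup y∉ys v∈ys (sym v≡y))

units : ℕ → List ℕ
units n = filter (λ k → coprime? k n) (List.map suc (List.upTo n))

units-unique : ∀ n → Unique (units n)
units-unique n = AllPairsₚ.filter⁺ (λ k → coprime? k n) (Uniqueₚ.map⁺ ℕₚ.suc-injective (Uniqueₚ.upTo⁺ n))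

∈-units : ∀ {k n} → Coprime k n → 1 ≤ k → k ≤ n → k ∈ units n
∈-units {suc k} k⊥n _ 1+k≤n = ∈ₚ.∈-filter⁺ (λ k → coprime? k _) (∈ₚ.∈-map⁺ suc (∈ₚ.∈-upTo⁺ 1+k≤n)) k⊥n

module PrimePowerUnits {p : ℕ} (p-prime : Prime p) (α : ℕ) where
  open ≡ using (sym; trans; cong; cong₂; subst; module ≡-Reasoning)
  open import Data.Nat using (_*_)
  open PrimePowers p-prime
  open Intervals

  r : ℕ
  r = p ^ suc α

  instance
    p≢0 : NonZero p
    p≢0 = prime⇒nonZero p-prime
    r≢0 : NonZero r
    r≢0 = ℕₚ.m^n≢0 p (suc α)
    p^α≢0 : NonZero (p ^ α)
    p^α≢0 = ℕₚ.m^n≢0 p α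

  private
    suc-pred-r : suc (ℕ.pred r) ≡ r
    suc-pred-r = ℕₚ.suc-pred r

  units-p^ : units r ≡ filter (¬? ∘ (p ∣?_)) (applyUpTo suc (ℕ.pred r))
  units-p^ = begin
    filter cop? (List.map suc (List.upTo r))
      ≡⟨ cong (filter cop?) (trans (Listₚ.map-upTo suc r) (applyUpTo-pred suc r)) ⟩
    filter cop? (applyUpTo suc (ℕ.pred r) ∷ʳ suc (ℕ.pred r))
      ≡⟨ Listₚ.filter-++ cop? (applyUpTo suc (ℕ.pred r)) _ ⟩
    filter cop? (applyUpTo suc (ℕ.pred r)) ++ filter cop? (suc (ℕ.pred r) ∷ [])
      ≡⟨ cong₂ _++_ (Listₚ.filter-≐ cop? (¬? ∘ (p ∣?_)) ((λ k⊥r p∣k → ∣⇒¬coprime-^ α p∣k k⊥r) , (λ p∤k → ∤⇒coprime-^ p∤k (suc α)))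
                                    (applyUpTo suc (ℕ.pred r)))
                    (Listₚ.filter-reject cop? (∣⇒¬coprime-^ α (subst (p ℕ∣.∣_) (sym suc-pred-r) (ℕ∣.m∣m*n (p ^ α))))) ⟩
    filter (¬? ∘ (p ∣?_)) (applyUpTo suc (ℕ.pred r)) ++ []
      ≡⟨ Listₚ.++-identityʳ _ ⟩
    filter (¬? ∘ (p ∣?_)) (applyUpTo suc (ℕ.pred r)) ∎
    where
    open ≡-Reasoning
    cop? : Decidable (λ k → Coprime k r)
    cop? = λ k → coprime? k r

  multiples-p : filter (p ∣?_) (applyUpTo suc (ℕ.pred r)) ≡ applyUpTo (λ j → p * suc j) (ℕ.pred (p ^ α))
  multiples-p = proj₁ (Listₚ.∷ʳ-injective _ _ (begin
    filter (p ∣?_) (applyUpTo suc (ℕ.pred r)) ∷ʳ r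
      ≡⟨ cong (filter (p ∣?_) (applyUpTo suc (ℕ.pred r)) ++_) (Listₚ.filter-accept (p ∣?_) (ℕ∣.m∣m*n (p ^ α))) ⟨
    filter (p ∣?_) (applyUpTo suc (ℕ.pred r)) ++ filter (p ∣?_) (r ∷ [])
      ≡⟨ Listₚ.filter-++ (p ∣?_) (applyUpTo suc (ℕ.pred r)) _ ⟨
    filter (p ∣?_) (applyUpTo suc (ℕ.pred r) ∷ʳ r)
      ≡⟨ cong (λ n → filter (p ∣?_) (applyUpTo suc (ℕ.pred r) ∷ʳ n)) suc-pred-r ⟨
    filter (p ∣?_) (applyUpTo suc (ℕ.pred r) ∷ʳ suc (ℕ.pred r))
      ≡⟨ cong (filter (p ∣?_)) (applyUpTo-pred suc r) ⟨
    filter (p ∣?_) (applyUpTo suc r)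
      ≡⟨ filter-∣-applyUpTo p (p ^ α) ⟩
    applyUpTo (λ j → p * suc j) (p ^ α)
      ≡⟨ applyUpTo-pred (λ j → p * suc j) (p ^ α) ⟩
    applyUpTo (λ j → p * suc j) (ℕ.pred (p ^ α)) ∷ʳ p * suc (ℕ.pred (p ^ α))
      ≡⟨ cong (λ n → applyUpTo (λ j → p * suc j) (ℕ.pred (p ^ α)) ∷ʳ p * n) (ℕₚ.suc-pred (p ^ α)) ⟩
    applyUpTo (λ j → p * suc j) (ℕ.pred (p ^ α)) ∷ʳ r ∎))
    where open ≡-Reasoning

module TwoPowerResidues {p : ℕ} (p-prime : Prime p) (p≢2 : p ≢ 2) (α s₀ : ℕ)
                        (s₀-order : IsMultOrderOf2Mod s₀ (p ^ suc α)) where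
  open ≡ using (refl; sym; cong; subst)
  open import Data.Integer using (-_)
  open PrimePowers p-prime
  open PrimePowerUnits p-prime α using (r; r≢0; p^α≢0)
  open Congruence r

  3≤r : 3 ≤ r
  3≤r = ℕₚ.≤-trans (1<n≢2⇒3≤n 1<p p≢2) (ℕₚ.m≤m*n p (p ^ α))
    where
    1<n≢2⇒3≤n : ∀ {n} → 1 < n → n ≢ 2 → 3 ≤ n
    1<n≢2⇒3≤n {suc zero} (s≤s ())
    1<n≢2⇒3≤n {suc (suc zero)}    _ n≢2 = ⊥-elim (n≢2 refl)
    1<n≢2⇒3≤n {suc (suc (suc _))} _ _   = s≤s (s≤s (s≤s z≤n))

  open PowersOfTwoModulo r s₀ 3≤r s₀-order

  res : ℕ → ℕ
  res j = 2 ^ j % r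

  negRes : ℕ → ℕ
  negRes j = r ∸ res j

  private
    res<r : ∀ j → res j < r
    res<r j = ℕₚ.m%n<n (2 ^ j) r

    p∣r : p ℕ∣.∣ r
    p∣r = ℕ∣.m∣m*n (p ^ α)

    p∤res : ∀ j → ¬ p ℕ∣.∣ res j
    p∤res j p∣res = p≢2 (∣2^⇒≡2 j (subst (p ℕ∣.∣_) (sym (ℕₚ.m≡m%n+[m/n]*n (2 ^ j) r))
                      (ℕ∣.∣m∣n⇒∣m+n p∣res (ℕ∣.∣n⇒∣m*n (2 ^ j / r) p∣r))))

    p∤negRes : ∀ j → ¬ p ℕ∣.∣ negRes j
    p∤negRes j p∣negRes =
      p∤res j (ℕ∣.∣m+n∣m⇒∣n (subst (p ℕ∣.∣_) (sym (ℕₚ.m∸n+n≡m (ℕₚ.<⇒≤ (res<r j)))) p∣r) p∣negRes)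

    ∤⇒∈units : ∀ {k} → ¬ p ℕ∣.∣ k → k ≤ r → k ∈ units r
    ∤⇒∈units {zero}  p∤0 _   = ⊥-elim (p∤0 (ℕ∣._∣0 p))
    ∤⇒∈units {suc k} p∤k k≤r = ∈-units (∤⇒coprime-^ p∤k (suc α)) (s≤s z≤n) k≤r

    two^≡ᵣres : ∀ j → two^ j ≡ᵣ + res j
    two^≡ᵣres j = m≡ᵣm%r (2 ^ j)

    res-injective : ∀ {i j} → i < j → j < s₀ → res i ≢ res j
    res-injective {i} {j} i<j j<s₀ eq =
      two^-injective i<j j<s₀ (≡ᵣ-trans (two^≡ᵣres i) (≡ᵣ-trans (≡ᵣ-reflexive (cong +_ eq)) (≡ᵣ-sym (two^≡ᵣres j))))

    negRes-injective : ∀ {i j} → i < j → j < s₀ → negRes i ≢ negRes j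
    negRes-injective {i} {j} i<j j<s₀ eq =
      res-injective i<j j<s₀ (ℕₚ.∸-cancelˡ-≡ (ℕₚ.<⇒≤ (res<r i)) (ℕₚ.<⇒≤ (res<r j)) eq)

    res≢negRes : s₀ % 2 ≡ 1 → ∀ {i j} → i < s₀ → j < s₀ → res i ≢ negRes j
    res≢negRes odd {i} {j} i<s₀ j<s₀ eq =
      two^≢ᵣ-two^ i<s₀ j<s₀ odd (≡ᵣ-trans (two^≡ᵣres i)
        (≡ᵣ-trans (≡ᵣ-reflexive (cong +_ eq))
        (≡ᵣ-trans (r∸a≡ᵣ-a (ℕₚ.<⇒≤ (res<r j))) (≡ᵣ-neg-cong (≡ᵣ-sym (two^≡ᵣres j))))))

  residues : List ℕ
  residues = applyUpTo res s₀

  negResidues : List ℕ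
  negResidues = applyUpTo negRes s₀

  residues-unique : Unique residues
  residues-unique = Uniqueₚ.applyUpTo⁺₁ res s₀ res-injective

  residues-⊆-units : ∀ {k} → k ∈ residues → k ∈ units r
  residues-⊆-units k∈ with j , _ , refl ← ∈ₚ.∈-applyUpTo⁻ res k∈ = ∤⇒∈units (p∤res j) (ℕₚ.<⇒≤ (res<r j))

  ±residues-unique : s₀ % 2 ≡ 1 → Unique (residues ++ negResidues)
  ±residues-unique odd = Uniqueₚ.++⁺ residues-unique (Uniqueₚ.applyUpTo⁺₁ negRes s₀ negRes-injective) disjoint
    where
    disjoint : ∀ {k} → ¬ (k ∈ residues × k ∈ negResidues)
    disjoint (k∈res , k∈negRes) with ∈ₚ.∈-applyUpTo⁻ res k∈res | ∈ₚ.∈-applyUpTo⁻ negRes k∈negRes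
    ... | i , i<s₀ , refl | j , j<s₀ , eq = res≢negRes odd i<s₀ j<s₀ eq

  ±residues-⊆-units : ∀ {k} → k ∈ residues ++ negResidues → k ∈ units r
  ±residues-⊆-units {k} k∈ with ∈ₚ.∈-++⁻ residues k∈
  ... | inj₁ k∈res = residues-⊆-units k∈res
  ... | inj₂ k∈negRes with j , _ , refl ← ∈ₚ.∈-applyUpTo⁻ negRes k∈negRes =
    ∤⇒∈units (p∤negRes j) (ℕₚ.m∸n≤m r (res j))

module RingLemmas {c ℓ} (R : CommutativeRing c ℓ) where
  open CommutativeRing R
  open RingProperties ring using (-‿involutive; -‿distribˡ-*; -‿distribʳ-*; -‿anti-homo-+; -0#≈0#)
  open import Relation.Binary.Reasoning.Setoid setoid

  ι : ℕ → Carrier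
  ι n = fromℤ R (ℤ.+ n)

  ι-+ : ∀ m n → ι (m ℕ.+ n) ≈ ι m + ι n
  ι-+ = SemiringMult.×-homo-+ semiring 1#

  ι-* : ∀ m n → ι (m ℕ.* n) ≈ ι m * ι n
  ι-* = SemiringMult.×1-homo-* semiring

  fromℤ-⊖ : ∀ m n → fromℤ R (m ℤ.⊖ n) ≈ ι m - ι n
  fromℤ-⊖ zero    zero    = sym (-‿inverseʳ 0#)
  fromℤ-⊖ zero    (suc n) = sym (+-identityˡ _)
  fromℤ-⊖ (suc m) zero    = sym (trans (+-congˡ -0#≈0#) (+-identityʳ _))
  fromℤ-⊖ (suc m) (suc n) = begin
    fromℤ R (suc m ℤ.⊖ suc n)       ≡⟨ ≡.cong (fromℤ R) (ℤₚ.[1+m]⊖[1+n]≡m⊖n m n) ⟩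
    fromℤ R (m ℤ.⊖ n)               ≈⟨ fromℤ-⊖ m n ⟩
    ι m - ι n                       ≈⟨ +-identityˡ _ ⟨
    0# + (ι m - ι n)                ≈⟨ +-congʳ (-‿inverseʳ 1#) ⟨
    (1# - 1#) + (ι m - ι n)         ≈⟨ +-assoc 1# (- 1#) _ ⟩
    1# + (- 1# + (ι m - ι n))       ≈⟨ +-congˡ (trans (sym (+-assoc _ _ _)) (trans (+-congʳ (+-comm _ _)) (+-assoc _ _ _))) ⟩
    1# + (ι m + (- 1# - ι n))       ≈⟨ +-assoc 1# (ι m) _ ⟨
    (1# + ι m) + (- 1# - ι n)       ≈⟨ +-congˡ (trans (-‿anti-homo-+ 1# (ι n)) (+-comm _ _)) ⟨
    (1# + ι m) - (1# + ι n)         ∎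

  fromℤ-neg : ∀ a → fromℤ R (ℤ.- a) ≈ - fromℤ R a
  fromℤ-neg ℤ.-[1+ n ]    = sym (-‿involutive _)
  fromℤ-neg (ℤ.+ zero)    = sym -0#≈0#
  fromℤ-neg (ℤ.+ (suc n)) = refl

  fromℤ-+ : ∀ a b → fromℤ R (a ℤ.+ b) ≈ fromℤ R a + fromℤ R b
  fromℤ-+ ℤ.-[1+ m ] ℤ.-[1+ n ] = begin
    - ι (suc (suc (m ℕ.+ n)))    ≡⟨ ≡.cong (λ k → - ι (suc k)) (≡.sym (ℕₚ.+-suc m n)) ⟩
    - ι (suc m ℕ.+ suc n)        ≈⟨ -‿cong (ι-+ (suc m) (suc n)) ⟩
    - (ι (suc m) + ι (suc n))    ≈⟨ -‿anti-homo-+ _ _ ⟩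
    - ι (suc n) + - ι (suc m)    ≈⟨ +-comm _ _ ⟩
    - ι (suc m) + - ι (suc n)    ∎
  fromℤ-+ ℤ.-[1+ m ] (ℤ.+ n)    = trans (fromℤ-⊖ n (suc m)) (+-comm _ _)
  fromℤ-+ (ℤ.+ m)    ℤ.-[1+ n ] = fromℤ-⊖ m (suc n)
  fromℤ-+ (ℤ.+ m)    (ℤ.+ n)    = ι-+ m n

  private
    signed : Sign → Carrier → Carrier
    signed Sign.+ x = x
    signed Sign.- x = - x

    fromℤ-◃ : ∀ s n → fromℤ R (s ℤ.◃ n) ≈ signed s (ι n)
    fromℤ-◃ Sign.- zero    = sym -0#≈0#
    fromℤ-◃ Sign.+ zero    = refl
    fromℤ-◃ Sign.- (suc n) = refl
    fromℤ-◃ Sign.+ (suc n) = refl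

    fromℤ-signed : ∀ a → fromℤ R a ≈ signed (ℤ.sign a) (ι ℤ.∣ a ∣)
    fromℤ-signed (ℤ.+ n)    = refl
    fromℤ-signed ℤ.-[1+ n ] = refl

    signed-* : ∀ s t x y → signed (s Sign.* t) (x * y) ≈ signed s x * signed t y
    signed-* Sign.+ Sign.+ x y = refl
    signed-* Sign.+ Sign.- x y = -‿distribʳ-* x y
    signed-* Sign.- Sign.+ x y = -‿distribˡ-* x y
    signed-* Sign.- Sign.- x y = begin
      x * y          ≈⟨ *-congʳ (-‿involutive x) ⟨
      - - x * y      ≈⟨ -‿distribˡ-* (- x) y ⟨
      - (- x * y)    ≈⟨ -‿distribʳ-* (- x) y ⟩
      - x * - y      ∎

  fromℤ-* : ∀ a b → fromℤ R (a ℤ.* b) ≈ fromℤ R a * fromℤ R b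
  fromℤ-* a b = begin
    fromℤ R (s ℤ.◃ ℤ.∣ a ∣ ℕ.* ℤ.∣ b ∣)                     ≈⟨ fromℤ-◃ s (ℤ.∣ a ∣ ℕ.* ℤ.∣ b ∣) ⟩
    signed s (ι (ℤ.∣ a ∣ ℕ.* ℤ.∣ b ∣))                      ≈⟨ signed-cong s (ι-* ℤ.∣ a ∣ ℤ.∣ b ∣) ⟩
    signed s (ι ℤ.∣ a ∣ * ι ℤ.∣ b ∣)                         ≈⟨ signed-* (ℤ.sign a) (ℤ.sign b) _ _ ⟩
    signed (ℤ.sign a) (ι ℤ.∣ a ∣) * signed (ℤ.sign b) (ι ℤ.∣ b ∣) ≈⟨ *-cong (fromℤ-signed a) (fromℤ-signed b) ⟨
    fromℤ R a * fromℤ R b                                    ∎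
    where
    s : Sign
    s = ℤ.sign a Sign.* ℤ.sign b
    signed-cong : ∀ s {x y} → x ≈ y → signed s x ≈ signed s y
    signed-cong Sign.+ x≈y = x≈y
    signed-cong Sign.- x≈y = -‿cong x≈y

  -- The solver interprets integer constants through this variant of fromℤ R, which sends 1 to 1# on the nose.
  private
    module ×′ = TCOptimised +-monoid

    ⟦_⟧ : ℤ → Carrier
    ⟦ ℤ.+ n ⟧    = n ×′.× 1#
    ⟦ ℤ.-[1+ n ] ⟧ = - (suc n ×′.× 1#)

    ⟦⟧≈fromℤ : ∀ a → ⟦ a ⟧ ≈ fromℤ R a
    ⟦⟧≈fromℤ (ℤ.+ n)    = sym (×′.×ᵤ≈× n 1#)
    ⟦⟧≈fromℤ ℤ.-[1+ n ] = -‿cong (sym (×′.×ᵤ≈× (suc n) 1#))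

    ⟦⟧-homomorphism : ℤ.+-*-rawRing -Raw-AlmostCommutative⟶ fromCommutativeRing R
    ⟦⟧-homomorphism = record
      { ⟦_⟧    = ⟦_⟧
      ; +-homo = λ a b → trans (⟦⟧≈fromℤ (a ℤ.+ b)) (trans (fromℤ-+ a b) (sym (+-cong (⟦⟧≈fromℤ a) (⟦⟧≈fromℤ b))))
      ; *-homo = λ a b → trans (⟦⟧≈fromℤ (a ℤ.* b)) (trans (fromℤ-* a b) (sym (*-cong (⟦⟧≈fromℤ a) (⟦⟧≈fromℤ b))))
      ; -‿homo = λ a → trans (⟦⟧≈fromℤ (ℤ.- a)) (trans (fromℤ-neg a) (sym (-‿cong (⟦⟧≈fromℤ a))))
      ; 0-homo = refl
      ; 1-homo = refl
      }

    ⟦⟧-≟ : ∀ a b → Maybe (⟦ a ⟧ ≈ ⟦ b ⟧)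
    ⟦⟧-≟ a b with a ℤ.≟ b
    ... | yes ≡.refl = just refl
    ... | no  _      = nothing

  open RingSolver ℤ.+-*-rawRing (fromCommutativeRing R) ⟦⟧-homomorphism ⟦⟧-≟ public
    using (solve; _:=_; _:+_; _:*_; :-_; _:-_; con)

  :0 :1 : ∀ {n} → RingSolver.Polynomial ℤ.+-*-rawRing (fromCommutativeRing R) ⟦⟧-homomorphism ⟦⟧-≟ n
  :0 = con (ℤ.+ 0)
  :1 = con (ℤ.+ 1)

  x-y≈0⇒x≈y : ∀ {x y} → x - y ≈ 0# → x ≈ y
  x-y≈0⇒x≈y {x} {y} x-y≈0 = begin
    x              ≈⟨ solve 2 (λ x y → x := (x :- y) :+ y) refl x y ⟩
    (x - y) + y    ≈⟨ +-congʳ x-y≈0 ⟩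
    0# + y         ≈⟨ +-identityˡ y ⟩
    y              ∎

  inverse-unique : ∀ {x x′ y} → x * y ≈ 1# → x′ * y ≈ 1# → x ≈ x′
  inverse-unique {x} {x′} {y} xy≈1 x′y≈1 = begin
    x              ≈⟨ *-identityʳ x ⟨
    x * 1#         ≈⟨ *-congˡ x′y≈1 ⟨
    x * (x′ * y)   ≈⟨ solve 3 (λ x x′ y → x :* (x′ :* y) := x′ :* (x :* y)) refl x x′ y ⟩
    x′ * (x * y)   ≈⟨ *-congˡ xy≈1 ⟩
    x′ * 1#        ≈⟨ *-identityʳ x′ ⟩
    x′             ∎

  *-cancelˡ : NoZeroDivisors R → ∀ {x y z} → ¬ x ≈ 0# → x * y ≈ x * z → y ≈ z
  *-cancelˡ no-zero-divisors {x} {y} {z} x≉0 xy≈xz with no-zero-divisors x (y - z)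
    (trans (solve 3 (λ a b c → a :* (b :- c) := a :* b :- a :* c) refl x y z) (trans (+-congʳ xy≈xz) (-‿inverseʳ _)))
  ... | inj₁ x≈0   = ⊥-elim (x≉0 x≈0)
  ... | inj₂ y-z≈0 = x-y≈0⇒x≈y y-z≈0

  pow-+ : ∀ x m n → pow R x (m ℕ.+ n) ≈ pow R x m * pow R x n
  pow-+ = SemiringExp.^-homo-* semiring

  pow-* : ∀ x m n → pow R x (m ℕ.* n) ≈ pow R (pow R x m) n
  pow-* x m n = sym (SemiringExp.^-assocʳ semiring x m n)

  pow-congˡ : ∀ {x y} n → x ≈ y → pow R x n ≈ pow R y n
  pow-congˡ n = SemiringExp.^-congˡ semiring n

  pow-distrib-* : ∀ x y n → pow R (x * y) n ≈ pow R x n * pow R y n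
  pow-distrib-* = CommutativeSemiringExp.^-distrib-* commutativeSemiring

  pow-1# : ∀ n → pow R 1# n ≈ 1#
  pow-1# zero    = refl
  pow-1# (suc n) = trans (*-identityˡ _) (pow-1# n)

  pow-[-1]-involutive : ∀ n → pow R (- 1#) n * pow R (- 1#) n ≈ 1#
  pow-[-1]-involutive n = begin
    pow R (- 1#) n * pow R (- 1#) n   ≈⟨ pow-distrib-* (- 1#) (- 1#) n ⟨
    pow R (- 1# * - 1#) n             ≈⟨ pow-congˡ n (solve 0 (:- :1 :* :- :1 := :1) refl) ⟩
    pow R 1# n                        ≈⟨ pow-1# n ⟩
    1#                                ∎

  pow-[-1]-odd : ∀ n → n % 2 ≡ 1 → pow R (- 1#) n ≈ - 1#
  pow-[-1]-odd n n%2≡1 = begin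
    pow R (- 1#) n                      ≡⟨ ≡.cong (pow R (- 1#)) (≡.trans (ℕₚ.m≡m%n+[m/n]*n n 2) (≡.cong (ℕ._+ (n / 2) ℕ.* 2) n%2≡1)) ⟩
    - 1# * pow R (- 1#) (n / 2 ℕ.* 2)   ≈⟨ *-congˡ (pow-* (- 1#) (n / 2) 2) ⟩
    - 1# * (u * (u * 1#))               ≈⟨ *-congˡ (trans (*-congˡ (*-identityʳ u)) (pow-[-1]-involutive (n / 2))) ⟩
    - 1# * 1#                           ≈⟨ solve 0 (:- :1 :* :1 := :- :1) refl ⟩
    - 1#                                ∎
    where u = pow R (- 1#) (n / 2)

  x*x≈y*y⇒x≈±y : NoZeroDivisors R → ∀ {x y} → x * x ≈ y * y → x ≈ y ⊎ x ≈ - y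
  x*x≈y*y⇒x≈±y no-zero-divisors {x} {y} x²≈y² with no-zero-divisors (x - y) (x + y) (begin
    (x - y) * (x + y)   ≈⟨ solve 2 (λ x y → (x :- y) :* (x :+ y) := x :* x :- y :* y) refl x y ⟩
    x * x - y * y       ≈⟨ +-congʳ x²≈y² ⟩
    y * y - y * y       ≈⟨ -‿inverseʳ _ ⟩
    0#                  ∎)
  ... | inj₁ x-y≈0 = inj₁ (x-y≈0⇒x≈y x-y≈0)
  ... | inj₂ x+y≈0 = inj₂ (x-y≈0⇒x≈y (trans (+-congˡ (-‿involutive y)) x+y≈0))

  HasExactOrder-pow : ∀ {x m n} → 0 < m → HasExactOrder R x (m ℕ.* n) → HasExactOrder R (pow R x m) n
  HasExactOrder-pow {x} {m} {n} 0<m (1≤mn , x^mn≈1 , x^k≉1) =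
    ℕ.>-nonZero⁻¹ n {{ℕₚ.m*n≢0⇒n≢0 m {{ℕ.>-nonZero 1≤mn}}}} ,
    trans (sym (pow-* x m n)) x^mn≈1 ,
    λ k 1≤k k<n x^mk≈1 → x^k≉1 (m ℕ.* k) (ℕₚ.*-mono-≤ 0<m 1≤k) (ℕₚ.*-monoʳ-< m {{ℕ.>-nonZero 0<m}} k<n) (trans (pow-* x m k) x^mk≈1)

  ∏ : ∀ {a} {A : Set a} → (A → Carrier) → List A → Carrier
  ∏ f []       = 1#
  ∏ f (x ∷ xs) = f x * ∏ f xs

  module _ {a} {A : Set a} where

    ∏-++ : ∀ (f : A → Carrier) xs ys → ∏ f (xs ++ ys) ≈ ∏ f xs * ∏ f ys
    ∏-++ f []       ys = sym (*-identityˡ _)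
    ∏-++ f (x ∷ xs) ys = trans (*-congˡ (∏-++ f xs ys)) (sym (*-assoc _ _ _))

    ∏-∷ʳ : ∀ (f : A → Carrier) xs x → ∏ f (xs ∷ʳ x) ≈ ∏ f xs * f x
    ∏-∷ʳ f xs x = trans (∏-++ f xs (x ∷ [])) (*-congˡ (*-identityʳ (f x)))

    ∏-cong : ∀ {f g : A → Carrier} xs → (∀ x → f x ≈ g x) → ∏ f xs ≈ ∏ g xs
    ∏-cong []       f≈g = refl
    ∏-cong (x ∷ xs) f≈g = *-cong (f≈g x) (∏-cong xs f≈g)

    ∏-map : ∀ {b} {B : Set b} (f : B → Carrier) (g : A → B) xs → ∏ f (List.map g xs) ≈ ∏ (f ∘ g) xs
    ∏-map f g []       = refl
    ∏-map f g (x ∷ xs) = *-congˡ (∏-map f g xs)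

    ∏-↭ : ∀ (f : A → Carrier) {xs ys} → xs ↭ ys → ∏ f xs ≈ ∏ f ys
    ∏-↭ f ↭.refl              = refl
    ∏-↭ f (↭.prep x xs↭ys)    = *-congˡ (∏-↭ f xs↭ys)
    ∏-↭ f (↭.swap x y xs↭ys)  = trans (*-congˡ (*-congˡ (∏-↭ f xs↭ys)))
      (solve 3 (λ a b c → a :* (b :* c) := b :* (a :* c)) refl (f x) (f y) _)
    ∏-↭ f (↭.trans xs↭ys ys↭zs) = trans (∏-↭ f xs↭ys) (∏-↭ f ys↭zs)

    ∏-filter : ∀ {p} {P : Pred A p} (P? : Decidable P) (f : A → Carrier) xs →
               ∏ f xs ≈ ∏ f (filter P? xs) * ∏ f (filter (¬? ∘ P?) xs)
    ∏-filter P? f []       = sym (*-identityˡ 1#)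
    ∏-filter P? f (x ∷ xs) with P? x
    ... | yes _ = trans (*-congˡ (∏-filter P? f xs)) (sym (*-assoc _ _ _))
    ... | no  _ = trans (*-congˡ (∏-filter P? f xs))
                    (solve 3 (λ a b c → a :* (b :* c) := b :* (a :* c)) refl (f x) _ _)

module ThueMorseProduct {c ℓ} (R : CommutativeRing c ℓ) where
  open CommutativeRing R
  open RingLemmas R
  open BinaryDigitSum
  open import Relation.Binary.Reasoning.Setoid setoid

  tmProduct : Carrier → ℕ → Carrier
  tmProduct x s = ∏ (λ j → 1# - pow R x (2 ^ j)) (upTo s)

  tmProduct-suc : ∀ x s → tmProduct x (suc s) ≈ tmProduct x s * (1# - pow R x (2 ^ s))
  tmProduct-suc x s = begin
    ∏ f (upTo (suc s))   ≡⟨ ≡.cong (∏ f) (Listₚ.upTo-∷ʳ s) ⟨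
    ∏ f (upTo s ∷ʳ s)    ≈⟨ ∏-∷ʳ f (upTo s) s ⟩
    ∏ f (upTo s) * f s   ∎
    where
    f = λ j → 1# - pow R x (2 ^ j)

  t-+2^ : ∀ s m → m < 2 ^ s → t R (m ℕ.+ 2 ^ s) ≈ - t R m
  t-+2^ s m m<2^s = begin
    pow R (- 1#) (s₂ (m ℕ.+ 2 ^ s))   ≡⟨ ≡.cong (pow R (- 1#)) (s₂[m+2^s]≡1+s₂[m] s m m<2^s) ⟩
    - 1# * pow R (- 1#) (s₂ m)        ≈⟨ solve 1 (λ a → :- :1 :* a := :- a) refl _ ⟩
    - pow R (- 1#) (s₂ m)             ∎

  -- On [2^s, 2^(s+1)) the signs are those of [0, 2^s) negated.
  T-2^+ : ∀ s b x → b ≤ 2 ^ s → T R (2 ^ s ℕ.+ b) x ≈ T R (2 ^ s) x - pow R x (2 ^ s) * T R b x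
  T-2^+ s zero x _ = begin
    T R (2 ^ s ℕ.+ 0) x              ≡⟨ ≡.cong (λ n → T R n x) (ℕₚ.+-identityʳ (2 ^ s)) ⟩
    T R (2 ^ s) x                    ≈⟨ solve 2 (λ a b → a := a :- b :* :0) refl _ _ ⟩
    T R (2 ^ s) x - pow R x (2 ^ s) * 0# ∎
  T-2^+ s (suc b) x 1+b≤2^s = begin
    T R (2 ^ s ℕ.+ suc b) x
      ≡⟨ ≡.cong (λ n → T R n x) (ℕₚ.+-suc (2 ^ s) b) ⟩
    T R (2 ^ s ℕ.+ b) x + t R (2 ^ s ℕ.+ b) * pow R x (2 ^ s ℕ.+ b)
      ≈⟨ +-cong (T-2^+ s b x (ℕₚ.<⇒≤ 1+b≤2^s))
                (*-cong (trans (reflexive (≡.cong (t R) (ℕₚ.+-comm (2 ^ s) b))) (t-+2^ s b 1+b≤2^s)) (pow-+ x (2 ^ s) b)) ⟩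
    (Tˢ - X * Tᵇ) + (- tᵇ) * (X * xᵇ)
      ≈⟨ solve 5 (λ Tˢ X Tᵇ tᵇ xᵇ → (Tˢ :- X :* Tᵇ) :+ (:- tᵇ) :* (X :* xᵇ) := Tˢ :- X :* (Tᵇ :+ tᵇ :* xᵇ))
               refl Tˢ X Tᵇ tᵇ xᵇ ⟩
    Tˢ - X * (Tᵇ + tᵇ * xᵇ) ∎
    where
    Tˢ X Tᵇ tᵇ xᵇ : Carrier
    Tˢ = T R (2 ^ s) x
    X  = pow R x (2 ^ s)
    Tᵇ = T R b x
    tᵇ = t R b
    xᵇ = pow R x b

  T-2^≈tmProduct : ∀ s x → T R (2 ^ s) x ≈ tmProduct x s
  T-2^≈tmProduct zero    x = solve 0 (:0 :+ :1 :* :1 := :1) refl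
  T-2^≈tmProduct (suc s) x = begin
    T R (2 ^ s ℕ.+ (2 ^ s ℕ.+ 0)) x      ≡⟨ ≡.cong (λ n → T R (2 ^ s ℕ.+ n) x) (ℕₚ.+-identityʳ (2 ^ s)) ⟩
    T R (2 ^ s ℕ.+ 2 ^ s) x              ≈⟨ T-2^+ s (2 ^ s) x ℕₚ.≤-refl ⟩
    T R (2 ^ s) x - X * T R (2 ^ s) x    ≈⟨ +-congˡ (-‿cong (*-congˡ IH)) ⟩
    T R (2 ^ s) x - X * tmProduct x s    ≈⟨ +-congʳ IH ⟩
    tmProduct x s - X * tmProduct x s    ≈⟨ solve 2 (λ a b → a :- b :* a := a :* (:1 :- b)) refl (tmProduct x s) X ⟩
    tmProduct x s * (1# - X)             ≈⟨ tmProduct-suc x s ⟨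
    tmProduct x (suc s)                  ∎
    where
    X : Carrier
    X  = pow R x (2 ^ s)
    IH : T R (2 ^ s) x ≈ tmProduct x s
    IH = T-2^≈tmProduct s x

module ElementarySymmetric {c ℓ} (R : CommutativeRing c ℓ) where
  open CommutativeRing R
  open RingLemmas R
  open import Relation.Binary.Reasoning.Setoid setoid

  e : ℕ → List Carrier → Carrier
  e zero    xs       = 1#
  e (suc j) []       = 0#
  e (suc j) (x ∷ xs) = e (suc j) xs + x * e j xs

  e-∷-cong : ∀ {x y xs ys} → x ≈ y → (∀ j → e j xs ≈ e j ys) → ∀ j → e j (x ∷ xs) ≈ e j (y ∷ ys)
  e-∷-cong x≈y eq zero    = refl
  e-∷-cong x≈y eq (suc j) = +-cong (eq (suc j)) (*-cong x≈y (eq j))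

  e-swap : ∀ j x y zs → e j (x ∷ y ∷ zs) ≈ e j (y ∷ x ∷ zs)
  e-swap zero          x y zs = refl
  e-swap (suc zero)    x y zs =
    solve 3 (λ a x y → (a :+ y :* :1) :+ x :* :1 := (a :+ x :* :1) :+ y :* :1) refl (e 1 zs) x y
  e-swap (suc (suc j)) x y zs =
    solve 5 (λ a b d x y → (a :+ y :* b) :+ x :* (b :+ y :* d) := (a :+ x :* b) :+ y :* (b :+ x :* d))
          refl (e (suc (suc j)) zs) (e (suc j) zs) (e j zs) x y

  e-∷ʳ : ∀ xs y j → e j (xs ∷ʳ y) ≈ e j (y ∷ xs)
  e-∷ʳ []       y j = refl
  e-∷ʳ (x ∷ xs) y j = trans (e-∷-cong refl (e-∷ʳ xs y) j) (e-swap j x y xs)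

  e-map-* : ∀ a xs j → e j (List.map (a *_) xs) ≈ pow R a j * e j xs
  e-map-* a xs       zero    = sym (*-identityˡ 1#)
  e-map-* a []       (suc j) = sym (zeroʳ _)
  e-map-* a (x ∷ xs) (suc j) = begin
    e (suc j) (List.map (a *_) xs) + a * x * e j (List.map (a *_) xs)
      ≈⟨ +-cong (e-map-* a xs (suc j)) (*-congˡ (e-map-* a xs j)) ⟩
    a * pow R a j * E₁ + a * x * (pow R a j * E₀)
      ≈⟨ solve 5 (λ a u E₁ x E₀ → a :* u :* E₁ :+ a :* x :* (u :* E₀) := a :* u :* (E₁ :+ x :* E₀)) refl a (pow R a j) E₁ x E₀ ⟩
    a * pow R a j * (E₁ + x * E₀) ∎
    where
    E₁ E₀ : Carrier
    E₁ = e (suc j) xs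
    E₀ = e j xs

  e-length< : ∀ xs j → length xs < j → e j xs ≈ 0#
  e-length< []       (suc j) _        = refl
  e-length< (x ∷ xs) (suc j) (s≤s lt) =
    trans (+-cong (e-length< xs (suc j) (ℕₚ.m<n⇒m<1+n lt)) (*-congˡ (e-length< xs j lt)))
          (trans (+-congˡ (zeroʳ x)) (+-identityʳ 0#))

  alternatingSum : ℕ → List Carrier → Carrier
  alternatingSum zero    xs = 0#
  alternatingSum (suc m) xs = alternatingSum m xs + pow R (- 1#) m * e m xs

  alternatingSum-∷ : ∀ m x xs → alternatingSum (suc m) (x ∷ xs) ≈ alternatingSum (suc m) xs - x * alternatingSum m xs
  alternatingSum-∷ zero    x xs = solve 1 (λ x → :0 :+ :1 :* :1 := (:0 :+ :1 :* :1) :- x :* :0) refl x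
  alternatingSum-∷ (suc m) x xs = begin
    alternatingSum (suc m) (x ∷ xs) + - 1# * u * (E₁ + x * E₀)  ≈⟨ +-congʳ (alternatingSum-∷ m x xs) ⟩
    (S₁ - x * S₀) + - 1# * u * (E₁ + x * E₀)
      ≈⟨ solve 6 (λ S₁ S₀ x u E₁ E₀ → (S₁ :- x :* S₀) :+ :- :1 :* u :* (E₁ :+ x :* E₀)
                                   := (S₁ :+ :- :1 :* u :* E₁) :- x :* (S₀ :+ u :* E₀))
               refl S₁ S₀ x u E₁ E₀ ⟩
    (S₁ + - 1# * u * E₁) - x * (S₀ + u * E₀) ∎
    where
    u E₁ E₀ S₁ S₀ : Carrier
    u  = pow R (- 1#) m
    E₁ = e (suc m) xs
    E₀ = e m xs
    S₁ = alternatingSum (suc m) xs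
    S₀ = alternatingSum m xs

  ∏[1-x]≈alternatingSum : ∀ xs → ∏ (λ x → 1# - x) xs ≈ alternatingSum (suc (length xs)) xs
  ∏[1-x]≈alternatingSum []       = solve 0 (:1 := :0 :+ :1 :* :1) refl
  ∏[1-x]≈alternatingSum (x ∷ xs) = sym (begin
    alternatingSum (suc (suc n)) (x ∷ xs)             ≈⟨ alternatingSum-∷ (suc n) x xs ⟩
    (S + pow R (- 1#) (suc n) * e (suc n) xs) - x * S ≈⟨ +-congʳ (+-congˡ (*-congˡ (e-length< xs (suc n) ℕₚ.≤-refl))) ⟩
    (S + pow R (- 1#) (suc n) * 0#) - x * S
      ≈⟨ solve 3 (λ S v x → (S :+ v :* :0) :- x :* S := (:1 :- x) :* S) refl S (pow R (- 1#) (suc n)) x ⟩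
    (1# - x) * S                                      ≈⟨ *-congˡ (∏[1-x]≈alternatingSum xs) ⟨
    (1# - x) * ∏ (λ x → 1# - x) xs                            ∎)
    where
    n : ℕ
    n = length xs
    S : Carrier
    S = alternatingSum (suc n) xs

module RootsOfUnityProduct {c ℓ} (R : CommutativeRing c ℓ) (no-zero-divisors : NoZeroDivisors R) where
  open CommutativeRing R
  open RingLemmas R
  open ElementarySymmetric R
  open import Relation.Binary.Reasoning.Setoid setoid

  -- With F = [ζ⁰, …, ζⁿ], multiplying by ζ permutes F cyclically, so ζʲ eⱼ(F) = eⱼ(F); as ζʲ ≠ 1, eⱼ(F) = 0 for 0 < j ≤ n.
  -- Hence eⱼ(ζ, …, ζⁿ) = (-1)ʲ, and ∏ (1 - ζᵏ) = Σⱼ (-1)ʲ eⱼ(ζ, …, ζⁿ) = n + 1.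
  ∏[1-ζ^k]≈order : ∀ {n} ζ → HasExactOrder R ζ (suc n) → ∏ (λ k → 1# - pow R ζ k) (applyUpTo suc n) ≈ ι (suc n)
  ∏[1-ζ^k]≈order {n} ζ (_ , ζ^[1+n]≈1 , ζ^k≉1) = begin
    ∏ (λ k → 1# - pow R ζ k) (applyUpTo suc n)   ≈⟨ ∏-map (λ x → 1# - x) (pow R ζ) (applyUpTo suc n) ⟨
    ∏ (λ x → 1# - x) (List.map (pow R ζ) (applyUpTo suc n)) ≡⟨ ≡.cong (∏ (λ x → 1# - x)) (Listₚ.map-applyUpTo suc (pow R ζ) n) ⟩
    ∏ (λ x → 1# - x) G                                  ≈⟨ ∏[1-x]≈alternatingSum G ⟩
    alternatingSum (suc (length G)) G            ≡⟨ ≡.cong (λ m → alternatingSum (suc m) G) (Listₚ.length-applyUpTo _ n) ⟩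
    alternatingSum (suc n) G                     ≈⟨ alternatingSum-G (suc n) ℕₚ.≤-refl ⟩
    ι (suc n)                                    ∎
    where
    G F : List Carrier
    G = applyUpTo (pow R ζ ∘ suc) n
    F = applyUpTo (pow R ζ) (suc n)

    ζ^j*e[F]≈e[F] : ∀ j → pow R ζ j * e j F ≈ e j F
    ζ^j*e[F]≈e[F] j = begin
      pow R ζ j * e j F                  ≈⟨ e-map-* ζ F j ⟨
      e j (List.map (ζ *_) F)            ≡⟨ ≡.cong (e j) (Listₚ.map-applyUpTo (pow R ζ) (ζ *_) (suc n)) ⟩
      e j (applyUpTo (pow R ζ ∘ suc) (suc n)) ≡⟨ ≡.cong (e j) (Listₚ.applyUpTo-∷ʳ (pow R ζ ∘ suc) n) ⟨
      e j (G ∷ʳ pow R ζ (suc n))         ≈⟨ e-∷ʳ G _ j ⟩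
      e j (pow R ζ (suc n) ∷ G)          ≈⟨ e-∷-cong ζ^[1+n]≈1 (λ _ → refl) j ⟩
      e j F                              ∎

    e[F]≈0 : ∀ j → 1 ≤ j → j < suc n → e j F ≈ 0#
    e[F]≈0 j 1≤j j<1+n with no-zero-divisors (pow R ζ j - 1#) (e j F)
      (trans (solve 2 (λ a b → (a :- :1) :* b := a :* b :- b) refl (pow R ζ j) (e j F))
             (trans (+-congʳ (ζ^j*e[F]≈e[F] j)) (-‿inverseʳ _)))
    ... | inj₁ ζ^j-1≈0 = ⊥-elim (ζ^k≉1 j 1≤j j<1+n (x-y≈0⇒x≈y ζ^j-1≈0))
    ... | inj₂ e[F]≈0 = e[F]≈0

    e[G]≈±1 : ∀ j → j ≤ n → e j G ≈ pow R (- 1#) j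
    e[G]≈±1 zero    _   = refl
    e[G]≈±1 (suc j) j<n = begin
      e (suc j) G                     ≈⟨ solve 2 (λ a b → a := (a :+ :1 :* b) :- b) refl (e (suc j) G) (e j G) ⟩
      e (suc j) F - e j G             ≈⟨ +-cong (e[F]≈0 (suc j) (s≤s z≤n) (s≤s j<n)) (-‿cong (e[G]≈±1 j (ℕₚ.<⇒≤ j<n))) ⟩
      0# - pow R (- 1#) j             ≈⟨ solve 1 (λ u → :0 :- u := :- :1 :* u) refl (pow R (- 1#) j) ⟩
      - 1# * pow R (- 1#) j           ∎

    alternatingSum-G : ∀ m → m ≤ suc n → alternatingSum m G ≈ ι m
    alternatingSum-G zero    _       = refl
    alternatingSum-G (suc m) (s≤s m≤n) = begin
      alternatingSum m G + pow R (- 1#) m * e m G       ≈⟨ +-cong (alternatingSum-G m (ℕₚ.m≤n⇒m≤1+n m≤n)) (*-congˡ (e[G]≈±1 m m≤n)) ⟩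
      ι m + pow R (- 1#) m * pow R (- 1#) m             ≈⟨ +-congˡ (pow-[-1]-involutive m) ⟩
      ι m + 1#                                          ≈⟨ +-comm _ _ ⟩
      ι (suc m)                                         ∎

module PrimitiveRootProduct {c ℓ} (R : CommutativeRing c ℓ) (char-zero : CharZero R) (no-zero-divisors : NoZeroDivisors R)
                            {p} (p-prime : Prime p) (α : ℕ)
                            (ω : CommutativeRing.Carrier R) (ω-order : HasExactOrder R ω (p ^ suc α)) where
  open CommutativeRing R
  open RingLemmas R
  open RootsOfUnityProduct R no-zero-divisors
  open PrimePowerUnits p-prime α
  open import Relation.Binary.Reasoning.Setoid setoid

  private
    f : ℕ → Carrier
    f k = 1# - pow R ω k

    N : ℕ
    N = p ^ α

    ∏-1≤k<r : ∏ f (applyUpTo suc (ℕ.pred r)) ≈ ι r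
    ∏-1≤k<r = trans (∏[1-ζ^k]≈order ω (≡.subst (HasExactOrder R ω) (≡.sym (ℕₚ.suc-pred r)) ω-order))
                  (reflexive (≡.cong ι (ℕₚ.suc-pred r)))

    ∏-multiples : ∏ f (filter (p ∣?_) (applyUpTo suc (ℕ.pred r))) ≈ ι N
    ∏-multiples = begin
      ∏ f (filter (p ∣?_) (applyUpTo suc (ℕ.pred r)))         ≡⟨ ≡.cong (∏ f) multiples-p ⟩
      ∏ f (applyUpTo (λ j → p ℕ.* suc j) (ℕ.pred N))          ≡⟨ ≡.cong (∏ f) (Listₚ.map-applyUpTo suc (p ℕ.*_) (ℕ.pred N)) ⟨
      ∏ f (List.map (p ℕ.*_) (applyUpTo suc (ℕ.pred N)))      ≈⟨ ∏-map f (p ℕ.*_) (applyUpTo suc (ℕ.pred N)) ⟩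
      ∏ (f ∘ (p ℕ.*_)) (applyUpTo suc (ℕ.pred N))
        ≈⟨ ∏-cong (applyUpTo suc (ℕ.pred N)) (λ k → +-congˡ (-‿cong (pow-* ω p k))) ⟩
      ∏ (λ k → 1# - pow R (pow R ω p) k) (applyUpTo suc (ℕ.pred N)) ≈⟨ ∏[1-ζ^k]≈order (pow R ω p) ω^p-order ⟩
      ι (suc (ℕ.pred N))                                      ≡⟨ ≡.cong ι (ℕₚ.suc-pred N) ⟩
      ι N                                                     ∎
      where
      ω^p-order : HasExactOrder R (pow R ω p) (suc (ℕ.pred N))
      ω^p-order = ≡.subst (HasExactOrder R (pow R ω p)) (≡.sym (ℕₚ.suc-pred N))
                    (HasExactOrder-pow (ℕ.>-nonZero⁻¹ p) ω-order)

  -- The product over all of 1, …, r - 1 is r, and over the multiples of p it is r / p.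
  ∏-units≈p : ∏ (λ k → 1# - pow R ω k) (units r) ≈ ι p
  ∏-units≈p = *-cancelˡ no-zero-divisors ιN≉0 (begin
    ι N * ∏ f (units r)                                      ≡⟨ ≡.cong (λ ks → ι N * ∏ f ks) units-p^ ⟩
    ι N * ∏ f (filter (¬? ∘ (p ∣?_)) ks)                      ≈⟨ *-congʳ ∏-multiples ⟨
    ∏ f (filter (p ∣?_) ks) * ∏ f (filter (¬? ∘ (p ∣?_)) ks)  ≈⟨ ∏-filter (p ∣?_) f ks ⟨
    ∏ f ks                                                   ≈⟨ ∏-1≤k<r ⟩
    ι (p ℕ.* N)                                              ≡⟨ ≡.cong ι (ℕₚ.*-comm p N) ⟩
    ι (N ℕ.* p)                                              ≈⟨ ι-* N p ⟩
    ι N * ι p                                                ∎)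
    where
    ks : List ℕ
    ks = applyUpTo suc (ℕ.pred r)
    ιN≉0 : ¬ ι N ≈ 0#
    ιN≉0 ιN≈0 = char-zero (ℕ.pred N) (trans (reflexive (≡.cong ι (ℕₚ.suc-pred N))) ιN≈0)

module IntegerSpan {c ℓ} (R : CommutativeRing c ℓ) where
  open CommutativeRing R
  open RingLemmas R
  open import Relation.Binary.Reasoning.Setoid setoid

  lin : List ℤ → List Carrier → Carrier
  lin []       es       = 0#
  lin (c ∷ cs) []       = 0#
  lin (c ∷ cs) (e ∷ es) = fromℤ R c * e + lin cs es

  _⊕_ : List ℤ → List ℤ → List ℤ
  []       ⊕ ds       = ds
  (c ∷ cs) ⊕ []       = c ∷ cs
  (c ∷ cs) ⊕ (d ∷ ds) = (c ℤ.+ d) ∷ (cs ⊕ ds)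

  lin-⊕ : ∀ cs ds es → lin (cs ⊕ ds) es ≈ lin cs es + lin ds es
  lin-⊕ []       ds       es       = sym (+-identityˡ _)
  lin-⊕ (c ∷ cs) []       []       = sym (+-identityˡ _)
  lin-⊕ (c ∷ cs) []       (e ∷ es) = sym (+-identityʳ _)
  lin-⊕ (c ∷ cs) (d ∷ ds) []       = sym (+-identityˡ _)
  lin-⊕ (c ∷ cs) (d ∷ ds) (e ∷ es) = trans (+-cong (*-congʳ (fromℤ-+ c d)) (lin-⊕ cs ds es))
    (solve 5 (λ a b e x y → (a :+ b) :* e :+ (x :+ y) := (a :* e :+ x) :+ (b :* e :+ y)) refl
           (fromℤ R c) (fromℤ R d) e (lin cs es) (lin ds es))

  lin-scale : ∀ z cs es → lin (List.map (z ℤ.*_) cs) es ≈ fromℤ R z * lin cs es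
  lin-scale z []       es       = sym (zeroʳ _)
  lin-scale z (c ∷ cs) []       = sym (zeroʳ _)
  lin-scale z (c ∷ cs) (e ∷ es) = trans (+-cong (*-congʳ (fromℤ-* z c)) (lin-scale z cs es))
    (solve 4 (λ a b e x → a :* b :* e :+ a :* x := a :* (b :* e :+ x)) refl (fromℤ R z) (fromℤ R c) e (lin cs es))

  lin-*ˡ : ∀ x cs es → x * lin cs es ≈ lin cs (List.map (x *_) es)
  lin-*ˡ x []       es       = zeroʳ x
  lin-*ˡ x (c ∷ cs) []       = zeroʳ x
  lin-*ˡ x (c ∷ cs) (e ∷ es) = trans
    (solve 4 (λ x a e l → x :* (a :* e :+ l) := a :* (x :* e) :+ x :* l) refl x (fromℤ R c) e (lin cs es))
    (+-congˡ (lin-*ˡ x cs es))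

  Span : List Carrier → Carrier → Set ℓ
  Span es x = ∃[ cs ] x ≈ lin cs es

  module _ {es : List Carrier} where

    Span-cong : ∀ {x y} → x ≈ y → Span es x → Span es y
    Span-cong x≈y (cs , x≈) = cs , trans (sym x≈y) x≈

    Span-0 : Span es 0#
    Span-0 = [] , refl

    Span-+ : ∀ {x y} → Span es x → Span es y → Span es (x + y)
    Span-+ (cs , x≈) (ds , y≈) = cs ⊕ ds , trans (+-cong x≈ y≈) (sym (lin-⊕ cs ds es))

    Span-scale : ∀ z {x} → Span es x → Span es (fromℤ R z * x)
    Span-scale z (cs , x≈) = List.map (z ℤ.*_) cs , trans (*-congˡ x≈) (sym (lin-scale z cs es))

    Span-lin : ∀ cs {xs} → All (Span es) xs → Span es (lin cs xs)
    Span-lin []       _          = Span-0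
    Span-lin (c ∷ cs) []         = Span-0
    Span-lin (c ∷ cs) (x∈ ∷ xs∈) = Span-+ (Span-scale c x∈) (Span-lin cs xs∈)

  indicator : ℕ → List ℤ
  indicator zero    = ℤ.+ 1 ∷ []
  indicator (suc i) = ℤ.+ 0 ∷ indicator i

  lin-indicator : ∀ (g : ℕ → Carrier) i m → i < m → lin (indicator i) (applyUpTo g m) ≈ g i
  lin-indicator g zero    (suc m) _         = solve 1 (λ x → (:1 :+ :0) :* x :+ :0 := x) refl (g 0)
  lin-indicator g (suc i) (suc m) (s≤s i<m) =
    trans (+-cong (zeroˡ (g 0)) (lin-indicator (g ∘ suc) i m i<m)) (+-identityˡ (g (suc i)))

  Span-applyUpTo : ∀ (g : ℕ → Carrier) {i m} → i < m → Span (applyUpTo g m) (g i)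
  Span-applyUpTo g {i} {m} i<m = indicator i , sym (lin-indicator g i m i<m)

module DeterminantTrick {c ℓ} (R : CommutativeRing c ℓ) (char-zero : CharZero R) (q : ℕ) (1<q : 1 < q) where
  open CommutativeRing R
  open RingLemmas R
  open IntegerSpan R
  open import Relation.Binary.Reasoning.Setoid setoid
  open import Data.Integer using (-[1+_])

  private
    Q : ℤ
    Q = + q

  ≡1[q] : ℤ → Set
  ≡1[q] d = ∃[ k ] d ≡ + 1 ℤ.+ Q ℤ.* k

  private
    1≡1[q] : ≡1[q] (+ 1)
    1≡1[q] = + 0 , ≡.sym (≡.trans (≡.cong (λ x → + 1 ℤ.+ x) (ℤₚ.*-zeroʳ Q)) (ℤₚ.+-identityʳ (+ 1)))

    *-≡1[q] : ∀ {a b} → ≡1[q] a → ≡1[q] b → ≡1[q] (a ℤ.* b)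
    *-≡1[q] (k , ≡.refl) (l , ≡.refl) = k ℤ.+ l ℤ.+ Q ℤ.* k ℤ.* l , eq Q k l
      where
      eq : ∀ q k l → (+ 1 ℤ.+ q ℤ.* k) ℤ.* (+ 1 ℤ.+ q ℤ.* l) ≡ + 1 ℤ.+ q ℤ.* (k ℤ.+ l ℤ.+ q ℤ.* k ℤ.* l)
      eq = solve-∀

    -‿q*-≡1[q] : ∀ {d} a → ≡1[q] d → ≡1[q] (d ℤ.- Q ℤ.* a)
    -‿q*-≡1[q] a (k , ≡.refl) = k ℤ.- a , eq Q k a
      where
      eq : ∀ q k a → (+ 1 ℤ.+ q ℤ.* k) ℤ.- q ℤ.* a ≡ + 1 ℤ.+ q ℤ.* (k ℤ.- a)
      eq = solve-∀

    ≡1[q]⇒fromℤ≉0 : ∀ {d} → ≡1[q] d → ¬ fromℤ R d ≈ 0#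
    ≡1[q]⇒fromℤ≉0 {+ zero}    (k , 0≡1+qk) _ = ℕₚ.<⇒≢ 1<q (≡.sym (ℕₚ.m*n≡1⇒m≡1 q ℤ.∣ k ∣ q∣k∣≡1))
      where
      qk≡-1 : Q ℤ.* k ≡ ℤ.- + 1
      qk≡-1 = ≡.trans (≡.sym (eq (Q ℤ.* k))) (≡.cong (ℤ._- + 1) (≡.sym 0≡1+qk))
        where
        eq : ∀ x → (+ 1 ℤ.+ x) ℤ.- + 1 ≡ x
        eq = solve-∀
      q∣k∣≡1 : q ℕ.* ℤ.∣ k ∣ ≡ 1
      q∣k∣≡1 = ≡.trans (≡.sym (ℤₚ.abs-* Q k)) (≡.cong ℤ.∣_∣ qk≡-1)
    ≡1[q]⇒fromℤ≉0 {+ suc n}   _ fromℤ≈0 = char-zero n fromℤ≈0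
    ≡1[q]⇒fromℤ≉0 { -[1+ n ]} _ fromℤ≈0 = char-zero n (trans (sym (-‿involutive _)) (trans (-‿cong fromℤ≈0) -0#≈0#))
      where open RingProperties ring using (-‿involutive; -0#≈0#)

  _·_⊆q·Span : ℤ → List Carrier → Set (c ⊔ ℓ)
  d · es ⊆q·Span = All (λ e → ∃[ cs ] fromℤ R d * e ≈ fromℤ R Q * lin cs es) es

  private
    head : List ℤ → ℤ
    head []       = + 0
    head (c ∷ cs) = c

    tail : List ℤ → List ℤ
    tail []       = []
    tail (c ∷ cs) = cs

    lin-∷ : ∀ cs e es → lin cs (e ∷ es) ≈ fromℤ R (head cs) * e + lin (tail cs) es
    lin-∷ []       e es = solve 1 (λ e → :0 := :0 :* e :+ :0) refl e
    lin-∷ (c ∷ cs) e es = refl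

    lin-annihilated : ∀ z cs es → All (λ e → fromℤ R z * e ≈ 0#) es → fromℤ R z * lin cs es ≈ 0#
    lin-annihilated z []       es       _           = zeroʳ _
    lin-annihilated z (c ∷ cs) []       _           = zeroʳ _
    lin-annihilated z (c ∷ cs) (e ∷ es) (ze≈0 ∷ zes≈0) = begin
      fromℤ R z * (fromℤ R c * e + lin cs es)
        ≈⟨ solve 4 (λ z c e l → z :* (c :* e :+ l) := c :* (z :* e) :+ z :* l) refl (fromℤ R z) (fromℤ R c) e (lin cs es) ⟩
      fromℤ R c * (fromℤ R z * e) + fromℤ R z * lin cs es
        ≈⟨ +-cong (*-congˡ ze≈0) (lin-annihilated z cs es zes≈0) ⟩
      fromℤ R c * 0# + 0#
        ≈⟨ solve 1 (λ c → c :* :0 :+ :0 := :0) refl (fromℤ R c) ⟩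
      0# ∎

    eliminate : ∀ d {e es} cs → fromℤ R d * e ≈ fromℤ R Q * lin cs (e ∷ es) →
                fromℤ R (d ℤ.- Q ℤ.* head cs) * e ≈ fromℤ R Q * lin (tail cs) es
    eliminate d {e} {es} cs de≈ = begin
      fromℤ R (d ℤ.- Q ℤ.* a) * e
        ≈⟨ *-congʳ (trans (fromℤ-+ d (ℤ.- (Q ℤ.* a))) (+-congˡ (trans (fromℤ-neg (Q ℤ.* a)) (-‿cong (fromℤ-* Q a))))) ⟩
      (fromℤ R d - fromℤ R Q * fromℤ R a) * e
        ≈⟨ solve 4 (λ d q a e → (d :- q :* a) :* e := d :* e :- q :* a :* e) refl (fromℤ R d) (fromℤ R Q) (fromℤ R a) e ⟩
      fromℤ R d * e - fromℤ R Q * fromℤ R a * e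
        ≈⟨ +-congʳ (trans de≈ (*-congˡ (lin-∷ cs e es))) ⟩
      fromℤ R Q * (fromℤ R a * e + L) - fromℤ R Q * fromℤ R a * e
        ≈⟨ solve 4 (λ q a e L → q :* (a :* e :+ L) :- q :* a :* e := q :* L) refl (fromℤ R Q) (fromℤ R a) e L ⟩
      fromℤ R Q * L ∎
      where
      a : ℤ
      a = head cs
      L : Carrier
      L = lin (tail cs) es

    reduce : ∀ c₁ d {e e′ es} Ls → fromℤ R c₁ * e ≈ fromℤ R Q * lin Ls es →
             ∃[ bs ] fromℤ R d * e′ ≈ fromℤ R Q * lin bs (e ∷ es) →
             ∃[ bs ] fromℤ R (c₁ ℤ.* d) * e′ ≈ fromℤ R Q * lin bs es
    reduce c₁ d {e} {e′} {es} Ls c₁e≈ (bs , de′≈) =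
      List.map ((Q ℤ.* b) ℤ.*_) Ls ⊕ List.map (c₁ ℤ.*_) (tail bs) , (begin
      fromℤ R (c₁ ℤ.* d) * e′
        ≈⟨ trans (*-congʳ (fromℤ-* c₁ d)) (*-assoc _ _ _) ⟩
      fromℤ R c₁ * (fromℤ R d * e′)
        ≈⟨ *-congˡ (trans de′≈ (*-congˡ (lin-∷ bs e es))) ⟩
      fromℤ R c₁ * (fromℤ R Q * (fromℤ R b * e + L′))
        ≈⟨ solve 5 (λ c q b e L → c :* (q :* (b :* e :+ L)) := q :* (b :* (c :* e)) :+ q :* (c :* L)) refl
                 (fromℤ R c₁) (fromℤ R Q) (fromℤ R b) e L′ ⟩
      fromℤ R Q * (fromℤ R b * (fromℤ R c₁ * e)) + fromℤ R Q * (fromℤ R c₁ * L′)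
        ≈⟨ +-congʳ (*-congˡ (*-congˡ c₁e≈)) ⟩
      fromℤ R Q * (fromℤ R b * (fromℤ R Q * L)) + fromℤ R Q * (fromℤ R c₁ * L′)
        ≈⟨ solve 5 (λ q b L c M → q :* (b :* (q :* L)) :+ q :* (c :* M) := q :* ((q :* b) :* L :+ c :* M)) refl
                 (fromℤ R Q) (fromℤ R b) L (fromℤ R c₁) L′ ⟩
      fromℤ R Q * (fromℤ R Q * fromℤ R b * L + fromℤ R c₁ * L′)
        ≈⟨ *-congˡ (+-cong (trans (*-congʳ (sym (fromℤ-* Q b))) (sym (lin-scale (Q ℤ.* b) Ls es)))
                           (sym (lin-scale c₁ (tail bs) es))) ⟩
      fromℤ R Q * (lin (List.map ((Q ℤ.* b) ℤ.*_) Ls) es + lin (List.map (c₁ ℤ.*_) (tail bs)) es)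
        ≈⟨ *-congˡ (lin-⊕ (List.map ((Q ℤ.* b) ℤ.*_) Ls) (List.map (c₁ ℤ.*_) (tail bs)) es) ⟨
      fromℤ R Q * lin (List.map ((Q ℤ.* b) ℤ.*_) Ls ⊕ List.map (c₁ ℤ.*_) (tail bs)) es ∎)
      where
      b : ℤ
      b  = head bs
      L L′ : Carrier
      L  = lin Ls es
      L′ = lin (tail bs) es

    annihilates-* : ∀ c′ c {x} → fromℤ R c * x ≈ 0# → fromℤ R (c ℤ.* c′) * x ≈ 0#
    annihilates-* c′ c {x} cx≈0 = begin
      fromℤ R (c ℤ.* c′) * x          ≈⟨ *-congʳ (fromℤ-* c c′) ⟩
      fromℤ R c * fromℤ R c′ * x      ≈⟨ solve 3 (λ a b x → a :* b :* x := b :* (a :* x)) refl (fromℤ R c) (fromℤ R c′) x ⟩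
      fromℤ R c′ * (fromℤ R c * x)    ≈⟨ *-congˡ cx≈0 ⟩
      fromℤ R c′ * 0#                 ≈⟨ zeroʳ _ ⟩
      0#                              ∎

  -- Elimination in place of a determinant: if d e = q (a e + L), then c₁ = d - q a gives c₁ e = q L,
  -- and multiplying the remaining relations by c₁ removes e from them.
  annihilator : ∀ es d → ≡1[q] d → d · es ⊆q·Span → ∃[ c ] ≡1[q] c × All (λ e → fromℤ R c * e ≈ 0#) es
  annihilator []       d _    _                  = + 1 , 1≡1[q] , []
  annihilator (e ∷ es) d d≡1 ((cs , de≈) ∷ des≈) =
    extend (annihilator es (c₁ ℤ.* d) (*-≡1[q] c₁≡1 d≡1) (All.map (reduce c₁ d (tail cs) c₁e≈) des≈))
    where
    c₁ : ℤ
    c₁ = d ℤ.- Q ℤ.* head cs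
    c₁≡1 : ≡1[q] c₁
    c₁≡1 = -‿q*-≡1[q] (head cs) d≡1
    c₁e≈ : fromℤ R c₁ * e ≈ fromℤ R Q * lin (tail cs) es
    c₁e≈ = eliminate d cs de≈
    extend : ∃[ c ] ≡1[q] c × All (λ e′ → fromℤ R c * e′ ≈ 0#) es →
             ∃[ c ] ≡1[q] c × All (λ e′ → fromℤ R c * e′ ≈ 0#) (e ∷ es)
    extend (c , c≡1 , ces≈0) = c ℤ.* c₁ , *-≡1[q] c≡1 c₁≡1 , cc₁e≈0 ∷ All.map (annihilates-* c₁ c) ces≈0
      where
      cc₁e≈0 : fromℤ R (c ℤ.* c₁) * e ≈ 0#
      cc₁e≈0 = begin
        fromℤ R (c ℤ.* c₁) * e              ≈⟨ trans (*-congʳ (fromℤ-* c c₁)) (*-assoc _ _ _) ⟩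
        fromℤ R c * (fromℤ R c₁ * e)        ≈⟨ *-congˡ c₁e≈ ⟩
        fromℤ R c * (fromℤ R Q * lin (tail cs) es)
          ≈⟨ solve 3 (λ c q L → c :* (q :* L) := q :* (c :* L)) refl (fromℤ R c) (fromℤ R Q) (lin (tail cs) es) ⟩
        fromℤ R Q * (fromℤ R c * lin (tail cs) es) ≈⟨ *-congˡ (lin-annihilated c (tail cs) es ces≈0) ⟩
        fromℤ R Q * 0#                      ≈⟨ zeroʳ _ ⟩
        0#                                  ∎

  ¬1·1∷es⊆q·Span : ∀ es → ¬ (+ 1) · (1# ∷ es) ⊆q·Span
  ¬1·1∷es⊆q·Span es hyp with annihilator (1# ∷ es) (+ 1) 1≡1[q] hyp
  ... | c , c≡1 , c·1≈0 ∷ _ = ≡1[q]⇒fromℤ≉0 c≡1 (trans (sym (*-identityʳ _)) c·1≈0)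

module CyclotomicIntegers {c ℓ} (R : CommutativeRing c ℓ) (ω : CommutativeRing.Carrier R) (r : ℕ) .{{_ : NonZero r}}
                          (ω^r≈1 : CommutativeRing._≈_ R (pow R ω r) (CommutativeRing.1# R)) where
  open CommutativeRing R
  open RingLemmas R
  open IntegerSpan R
  open import Relation.Binary.Reasoning.Setoid setoid

  powers : List Carrier
  powers = applyUpTo (pow R ω) r

  ℤ[ω] : Carrier → Set ℓ
  ℤ[ω] = Span powers

  ω^[m*r]≈1 : ∀ m → pow R ω (m ℕ.* r) ≈ 1#
  ω^[m*r]≈1 m = trans (reflexive (≡.cong (pow R ω) (ℕₚ.*-comm m r)))
                 (trans (pow-* ω r m) (trans (pow-congˡ m ω^r≈1) (pow-1# m)))

  pow-% : ∀ k → pow R ω (k % r) ≈ pow R ω k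
  pow-% k = sym (begin
    pow R ω k                                  ≡⟨ ≡.cong (pow R ω) (ℕₚ.m≡m%n+[m/n]*n k r) ⟩
    pow R ω (k % r ℕ.+ k / r ℕ.* r)            ≈⟨ pow-+ ω (k % r) _ ⟩
    pow R ω (k % r) * pow R ω (k / r ℕ.* r)    ≈⟨ *-congˡ (ω^[m*r]≈1 (k / r)) ⟩
    pow R ω (k % r) * 1#                       ≈⟨ *-identityʳ _ ⟩
    pow R ω (k % r)                            ∎)

  ℤ[ω]-pow : ∀ k → ℤ[ω] (pow R ω k)
  ℤ[ω]-pow k = Span-cong (pow-% k) (Span-applyUpTo (pow R ω) (ℕₚ.m%n<n k r))

  ℤ[ω]-1 : ℤ[ω] 1#
  ℤ[ω]-1 = ℤ[ω]-pow 0

  ℤ[ω]-ω : ℤ[ω] ω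
  ℤ[ω]-ω = Span-cong (*-identityʳ ω) (ℤ[ω]-pow 1)

  ℤ[ω]-fromℤ : ∀ z → ℤ[ω] (fromℤ R z)
  ℤ[ω]-fromℤ z = Span-cong (*-identityʳ _) (Span-scale z ℤ[ω]-1)

  ℤ[ω]-neg : ∀ {x} → ℤ[ω] x → ℤ[ω] (- x)
  ℤ[ω]-neg {x} x∈ = Span-cong (solve 1 (λ x → (:- (:1 :+ :0)) :* x := :- x) refl x) (Span-scale (ℤ.- ℤ.+ 1) x∈)

  private
    ℤ[ω]-pow-* : ∀ k {x} → ℤ[ω] x → ℤ[ω] (pow R ω k * x)
    ℤ[ω]-pow-* k (cs , x≈) = Span-cong (sym (trans (*-congˡ x≈) (lin-*ˡ (pow R ω k) cs powers)))
      (Span-lin cs (Allₚ.map⁺ (Allₚ.applyUpTo⁺₂ (pow R ω) r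
        (λ j → Span-cong (pow-+ ω k j) (ℤ[ω]-pow (k ℕ.+ j))))))

  ℤ[ω]-* : ∀ {x y} → ℤ[ω] x → ℤ[ω] y → ℤ[ω] (x * y)
  ℤ[ω]-* {x} x∈ (ds , y≈) = Span-cong (sym (trans (*-congˡ y≈) (lin-*ˡ x ds powers)))
    (Span-lin ds (Allₚ.map⁺ (Allₚ.applyUpTo⁺₂ (pow R ω) r (λ j → Span-cong (*-comm _ _) (ℤ[ω]-pow-* j x∈)))))

  ℤ[ω]-∏ : ∀ {a} {A : Set a} (f : A → Carrier) → (∀ k → ℤ[ω] (f k)) → ∀ ks → ℤ[ω] (∏ f ks)
  ℤ[ω]-∏ f f∈ []       = ℤ[ω]-1
  ℤ[ω]-∏ f f∈ (k ∷ ks) = ℤ[ω]-* (f∈ k) (ℤ[ω]-∏ f f∈ ks)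

  IsUnit : Carrier → Set (c ⊔ ℓ)
  IsUnit x = ∃[ y ] ℤ[ω] y × x * y ≈ 1#

  IsUnit-cong : ∀ {x y} → x ≈ y → IsUnit x → IsUnit y
  IsUnit-cong x≈y (z , z∈ , xz≈1) = z , z∈ , trans (*-congʳ (sym x≈y)) xz≈1

  IsUnit-∏ : ∀ {a} {A : Set a} (f : A → Carrier) {ks} → All (IsUnit ∘ f) ks → IsUnit (∏ f ks)
  IsUnit-∏ f []                         = 1# , ℤ[ω]-1 , *-identityʳ 1#
  IsUnit-∏ f {k ∷ ks} ((y , y∈ , fy≈1) ∷ ks-units) with IsUnit-∏ f ks-units
  ... | z , z∈ , ∏z≈1 = y * z , ℤ[ω]-* y∈ z∈ , (begin
    (f k * ∏ f ks) * (y * z)   ≈⟨ solve 4 (λ a b c d → (a :* b) :* (c :* d) := (a :* c) :* (b :* d)) refl (f k) (∏ f ks) y z ⟩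
    (f k * y) * (∏ f ks * z)   ≈⟨ *-cong fy≈1 ∏z≈1 ⟩
    1# * 1#                    ≈⟨ *-identityʳ 1# ⟩
    1#                         ∎)

  -- ℤ[ω] is a finitely generated ℤ-module, so the determinant trick applies to it.
  ι-nonunit : CharZero R → ∀ {q} → 1 < q → ¬ IsUnit (ι q)
  ι-nonunit char-zero {q} 1<q (h , h∈ , qh≈1) =
    ¬1·1∷es⊆q·Span (applyUpTo (pow R ω ∘ suc) (ℕ.pred r))
      (≡.subst (λ es → (ℤ.+ 1) · es ⊆q·Span) powers≡1∷ (Allₚ.applyUpTo⁺₂ (pow R ω) r ω^k∈q·ℤ[ω]))
    where
    open DeterminantTrick R char-zero q 1<q using (_·_⊆q·Span; ¬1·1∷es⊆q·Span)
    powers≡1∷ : powers ≡ 1# ∷ applyUpTo (pow R ω ∘ suc) (ℕ.pred r)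
    powers≡1∷ = ≡.cong (applyUpTo (pow R ω)) (≡.sym (ℕₚ.suc-pred r))
    ω^k∈q·ℤ[ω] : ∀ k → ∃[ cs ] fromℤ R (ℤ.+ 1) * pow R ω k ≈ ι q * lin cs powers
    ω^k∈q·ℤ[ω] k with cs , hω^k≈ ← ℤ[ω]-* h∈ (ℤ[ω]-pow k) = cs , (begin
      fromℤ R (ℤ.+ 1) * pow R ω k   ≈⟨ solve 1 (λ w → (:1 :+ :0) :* w := :1 :* w) refl (pow R ω k) ⟩
      1# * pow R ω k                ≈⟨ *-congʳ qh≈1 ⟨
      ι q * h * pow R ω k           ≈⟨ *-assoc _ _ _ ⟩
      ι q * (h * pow R ω k)         ≈⟨ *-congˡ hω^k≈ ⟩
      ι q * lin cs powers           ∎)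

module PrimitiveRootUnits {c ℓ} (R : CommutativeRing c ℓ) (char-zero : CharZero R) (no-zero-divisors : NoZeroDivisors R)
                          {p} (p-prime : Prime p) (α : ℕ)
                          (ω : CommutativeRing.Carrier R) (ω-order : HasExactOrder R ω (p ^ suc α)) where
  open CommutativeRing R
  open RingLemmas R
  open PrimePowerUnits p-prime α using (r; r≢0)
  open PrimePowers p-prime using (1<p)
  open import Relation.Binary.Reasoning.Setoid setoid

  open CyclotomicIntegers R ω r (proj₁ (proj₂ ω-order)) public

  geometric : Carrier → ℕ → Carrier
  geometric y zero    = 0#
  geometric y (suc n) = 1# + y * geometric y n

  [1-y]*geometric : ∀ y n → (1# - y) * geometric y n ≈ 1# - pow R y n
  [1-y]*geometric y zero    = solve 1 (λ y → (:1 :- y) :* :0 := :1 :- :1) refl y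
  [1-y]*geometric y (suc n) = begin
    (1# - y) * (1# + y * geometric y n)
      ≈⟨ solve 2 (λ y g → (:1 :- y) :* (:1 :+ y :* g) := (:1 :- y) :+ y :* ((:1 :- y) :* g)) refl y (geometric y n) ⟩
    (1# - y) + y * ((1# - y) * geometric y n) ≈⟨ +-congˡ (*-congˡ ([1-y]*geometric y n)) ⟩
    (1# - y) + y * (1# - pow R y n)       ≈⟨ solve 2 (λ y u → (:1 :- y) :+ y :* (:1 :- u) := :1 :- y :* u) refl y (pow R y n) ⟩
    1# - y * pow R y n                    ∎

  ℤ[ω]-geometric : ∀ {y} → ℤ[ω] y → ∀ n → ℤ[ω] (geometric y n)
  ℤ[ω]-geometric y∈ zero    = IntegerSpan.Span-0 R
  ℤ[ω]-geometric y∈ (suc n) = IntegerSpan.Span-+ R ℤ[ω]-1 (ℤ[ω]-* y∈ (ℤ[ω]-geometric y∈ n))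

  -- Bézout gives k x ≡ ±1 (mod r), so 1 - ω is 1 - ωᵏ times a geometric sum, up to the factor -ω.
  [1-ω^k]∣[1-ω] : ∀ {k} → Coprime k r → ∃[ w ] ℤ[ω] w × (1# - pow R ω k) * w ≈ 1# - ω
  [1-ω^k]∣[1-ω] {k} k⊥r with Coprimality.coprime-Bézout k⊥r
  ... | Bézout.+- x y 1+yr≡xk = geometric (pow R ω k) x , ℤ[ω]-geometric (ℤ[ω]-pow k) x , (begin
    (1# - pow R ω k) * geometric (pow R ω k) x   ≈⟨ [1-y]*geometric (pow R ω k) x ⟩
    1# - pow R (pow R ω k) x                     ≈⟨ +-congˡ (-‿cong (pow-* ω k x)) ⟨
    1# - pow R ω (k ℕ.* x)                       ≡⟨ ≡.cong (λ m → 1# - pow R ω m) (≡.trans (ℕₚ.*-comm k x) (≡.sym 1+yr≡xk)) ⟩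
    1# - ω * pow R ω (y ℕ.* r)                   ≈⟨ +-congˡ (-‿cong (trans (*-congˡ (ω^[m*r]≈1 y)) (*-identityʳ ω))) ⟩
    1# - ω                                       ∎)
  ... | Bézout.-+ x y 1+xk≡yr = geometric (pow R ω k) x * - ω ,
      ℤ[ω]-* (ℤ[ω]-geometric (ℤ[ω]-pow k) x) (ℤ[ω]-neg ℤ[ω]-ω) , (begin
    (1# - pow R ω k) * (geometric (pow R ω k) x * - ω)   ≈⟨ *-assoc _ _ _ ⟨
    (1# - pow R ω k) * geometric (pow R ω k) x * - ω     ≈⟨ *-congʳ ([1-y]*geometric (pow R ω k) x) ⟩
    (1# - pow R (pow R ω k) x) * - ω                     ≈⟨ *-congʳ (+-congˡ (-‿cong (pow-* ω k x))) ⟨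
    (1# - pow R ω (k ℕ.* x)) * - ω
      ≈⟨ solve 2 (λ u w → (:1 :- u) :* :- w := (:1 :- w) :+ (w :* u :- :1)) refl (pow R ω (k ℕ.* x)) ω ⟩
    (1# - ω) + (ω * pow R ω (k ℕ.* x) - 1#)
      ≡⟨ ≡.cong (λ m → (1# - ω) + (pow R ω m - 1#)) (≡.trans (≡.cong suc (ℕₚ.*-comm k x)) 1+xk≡yr) ⟩
    (1# - ω) + (pow R ω (y ℕ.* r) - 1#)                  ≈⟨ +-congˡ (+-congʳ (ω^[m*r]≈1 y)) ⟩
    (1# - ω) + (1# - 1#)                                 ≈⟨ solve 1 (λ l → l :+ (:1 :- :1) := l) refl (1# - ω) ⟩
    1# - ω                                               ∎)

  -- If 1 - ω were a unit, so would be every 1 - ωᵏ with k a unit mod r, and hence their product p.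
  1-ω-nonunit : ¬ IsUnit (1# - ω)
  1-ω-nonunit (g , g∈ , [1-ω]g≈1) = ι-nonunit char-zero 1<p
    (IsUnit-cong ∏-units≈p (IsUnit-∏ (λ k → 1# - pow R ω k) (All.tabulate factor-unit)))
    where
    open PrimitiveRootProduct R char-zero no-zero-divisors p-prime α ω ω-order using (∏-units≈p)
    factor-unit : ∀ {k} → k ∈ units r → IsUnit (1# - pow R ω k)
    factor-unit k∈
      with w , w∈ , [1-ω^k]w≈1-ω ← [1-ω^k]∣[1-ω] (proj₂ (∈ₚ.∈-filter⁻ (λ k → coprime? k r) {xs = List.map suc (upTo r)} k∈)) =
      w * g , ℤ[ω]-* w∈ g∈ , trans (sym (*-assoc _ _ _)) (trans (*-congʳ [1-ω^k]w≈1-ω) [1-ω]g≈1)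

  infix 4 [1-ω]∣_
  [1-ω]∣_ : Carrier → Set (c ⊔ ℓ)
  [1-ω]∣ x = ∃[ g ] ℤ[ω] g × x ≈ (1# - ω) * g

  [1-ω]∣-cong : ∀ {x y} → x ≈ y → [1-ω]∣ x → [1-ω]∣ y
  [1-ω]∣-cong x≈y (g , g∈ , x≈) = g , g∈ , trans (sym x≈y) x≈

  [1-ω]∣-*ˡ : ∀ {x y} → ℤ[ω] y → [1-ω]∣ x → [1-ω]∣ y * x
  [1-ω]∣-*ˡ {y = y} y∈ (g , g∈ , x≈) = y * g , ℤ[ω]-* y∈ g∈ ,
    trans (*-congˡ x≈) (solve 3 (λ y l g → y :* (l :* g) := l :* (y :* g)) refl y (1# - ω) g)

  [1-ω]∣-ι-* : ∀ m {n} → [1-ω]∣ ι n → [1-ω]∣ ι (m ℕ.* n)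
  [1-ω]∣-ι-* m {n} ∣ιn = [1-ω]∣-cong (sym (ι-* m n)) ([1-ω]∣-*ˡ (ℤ[ω]-fromℤ (ℤ.+ m)) ∣ιn)

  ¬[1-ω]∣1 : ¬ [1-ω]∣ 1#
  ¬[1-ω]∣1 (g , g∈ , 1≈[1-ω]g) = 1-ω-nonunit (g , g∈ , sym 1≈[1-ω]g)

  ¬[1-ω]∣consecutive : ∀ {a b} → suc a ≡ b → [1-ω]∣ ι a → ¬ [1-ω]∣ ι b
  ¬[1-ω]∣consecutive {a} ≡.refl (g , g∈ , ιa≈) (h , h∈ , ι[1+a]≈) = ¬[1-ω]∣1
    (h - g , IntegerSpan.Span-+ R h∈ (ℤ[ω]-neg g∈) , (begin
      1#                        ≈⟨ solve 1 (λ a → :1 := (:1 :+ a) :- a) refl (ι a) ⟩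
      ι (suc a) - ι a           ≈⟨ +-cong ι[1+a]≈ (-‿cong ιa≈) ⟩
      (1# - ω) * h - (1# - ω) * g ≈⟨ solve 3 (λ l h g → l :* h :- l :* g := l :* (h :- g)) refl (1# - ω) h g ⟩
      (1# - ω) * (h - g)        ∎))

  -- If p = n (1 - ω) V with 1 - ω dividing n: either p divides n and 1 - ω becomes a unit after cancelling p,
  -- or n and p are coprime and 1 - ω divides 1 by Bézout.
  ¬ι[p]≈ι[n]*[1-ω]*V : ∀ n {V} → ℤ[ω] V → [1-ω]∣ ι n → ¬ ι p ≈ ι n * ((1# - ω) * V)
  ¬ι[p]≈ι[n]*[1-ω]*V n {V} V∈ ∣ιn ιp≈ with p ℕ∣.∣? n
  ... | yes (ℕ∣.divides m ≡.refl) = 1-ω-nonunit (ι m * V , ℤ[ω]-* (ℤ[ω]-fromℤ (ℤ.+ m)) V∈ ,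
    sym (*-cancelˡ no-zero-divisors ιp≉0 (begin
      ι p * 1#                         ≈⟨ *-identityʳ _ ⟩
      ι p                              ≈⟨ ιp≈ ⟩
      ι (m ℕ.* p) * ((1# - ω) * V)     ≈⟨ *-congʳ (ι-* m p) ⟩
      ι m * ι p * ((1# - ω) * V)       ≈⟨ solve 4 (λ m q l v → m :* q :* (l :* v) := q :* (l :* (m :* v))) refl (ι m) (ι p) (1# - ω) V ⟩
      ι p * ((1# - ω) * (ι m * V))     ∎)))
    where
    ιp≉0 : ¬ ι p ≈ 0#
    ιp≉0 ιp≈0 = char-zero (ℕ.pred p) (trans (reflexive (≡.cong ι (ℕₚ.suc-pred p {{p≢0}}))) ιp≈0)
      where open PrimePowerUnits p-prime α using (p≢0)
  ... | no p∤n = by-Bézout (Coprimality.coprime-Bézout (∤⇒coprime p∤n))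
    where
    open PrimePowers p-prime using (∤⇒coprime)
    ∣ιp : [1-ω]∣ ι p
    ∣ιp = ι n * V , ℤ[ω]-* (ℤ[ω]-fromℤ (ℤ.+ n)) V∈ ,
      trans ιp≈ (solve 3 (λ a l v → a :* (l :* v) := l :* (a :* v)) refl (ι n) (1# - ω) V)
    by-Bézout : Bézout.Identity 1 n p → ⊥
    by-Bézout (Bézout.+- x y 1+yp≡xn) = ¬[1-ω]∣consecutive 1+yp≡xn ([1-ω]∣-ι-* y ∣ιp) ([1-ω]∣-ι-* x ∣ιn)
    by-Bézout (Bézout.-+ x y 1+xn≡yp) = ¬[1-ω]∣consecutive 1+xn≡yp ([1-ω]∣-ι-* x ∣ιn) ([1-ω]∣-ι-* y ∣ιp)

module ThueMorseAtPrimePowerRoots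
  {c ℓ} (R : CommutativeRing c ℓ) (char-zero : CharZero R) (no-zero-divisors : NoZeroDivisors R)
  {p} (p-prime : Prime p) (p≢2 : p ≢ 2) (α s₀ : ℕ)
  (ω : CommutativeRing.Carrier R) (ω-order : HasExactOrder R ω (p ^ suc α))
  (s₀-order : IsMultOrderOf2Mod s₀ (p ^ suc α)) where

  open CommutativeRing R
  open RingLemmas R
  open ThueMorseProduct R
  open PrimePowerUnits p-prime α using (r; r≢0)
  open TwoPowerResidues p-prime p≢2 α s₀ s₀-order
  open PrimitiveRootProduct R char-zero no-zero-divisors p-prime α ω ω-order using (∏-units≈p)
  open PrimitiveRootUnits R char-zero no-zero-divisors p-prime α ω ω-order
  open DuplicateFree using (unique-⊆⇒↭++)
  open import Relation.Binary.Reasoning.Setoid setoid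

  ω⁻¹ : Carrier
  ω⁻¹ = pow R ω (r ∸ 1)

  ω⁻¹*ω≈1 : ω⁻¹ * ω ≈ 1#
  ω⁻¹*ω≈1 = begin
    ω⁻¹ * ω                     ≈⟨ *-congˡ (*-identityʳ ω) ⟨
    ω⁻¹ * pow R ω 1             ≈⟨ pow-+ ω (r ∸ 1) 1 ⟨
    pow R ω (r ∸ 1 ℕ.+ 1)       ≡⟨ ≡.cong (pow R ω) (ℕₚ.m∸n+n≡m (ℕ.>-nonZero⁻¹ r)) ⟩
    pow R ω r                   ≈⟨ proj₁ (proj₂ ω-order) ⟩
    1#                          ∎

  private
    f : ℕ → Carrier
    f k = 1# - pow R ω k

    ω⁻¹^2^*ω^2^≈1 : ∀ j → pow R ω⁻¹ (2 ^ j) * pow R ω (2 ^ j) ≈ 1#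
    ω⁻¹^2^*ω^2^≈1 j = trans (sym (pow-distrib-* ω⁻¹ ω (2 ^ j))) (trans (pow-congˡ (2 ^ j) ω⁻¹*ω≈1) (pow-1# (2 ^ j)))

    ∏-applyUpTo-s₀ : ∀ (g : ℕ → ℕ) x → (∀ j → f (g j) ≈ 1# - pow R x (2 ^ j)) → ∏ f (applyUpTo g s₀) ≈ tmProduct x s₀
    ∏-applyUpTo-s₀ g x fg≈ = begin
      ∏ f (applyUpTo g s₀)           ≡⟨ ≡.cong (∏ f) (Listₚ.map-upTo g s₀) ⟨
      ∏ f (List.map g (upTo s₀))     ≈⟨ ∏-map f g (upTo s₀) ⟩
      ∏ (f ∘ g) (upTo s₀)            ≈⟨ ∏-cong (upTo s₀) fg≈ ⟩
      tmProduct x s₀                 ∎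

  ∏-residues : ∏ f residues ≈ tmProduct ω s₀
  ∏-residues = ∏-applyUpTo-s₀ res ω (λ j → +-congˡ (-‿cong (pow-% (2 ^ j))))

  ∏-negResidues : ∏ f negResidues ≈ tmProduct ω⁻¹ s₀
  ∏-negResidues = ∏-applyUpTo-s₀ negRes ω⁻¹ (λ j → +-congˡ (-‿cong (inverse-unique (ω^negRes*ω^2^≈1 j) (ω⁻¹^2^*ω^2^≈1 j))))
    where
    ω^negRes*ω^2^≈1 : ∀ j → pow R ω (negRes j) * pow R ω (2 ^ j) ≈ 1#
    ω^negRes*ω^2^≈1 j = begin
      pow R ω (negRes j) * pow R ω (2 ^ j)   ≈⟨ *-congˡ (pow-% (2 ^ j)) ⟨
      pow R ω (negRes j) * pow R ω (res j)   ≈⟨ pow-+ ω (negRes j) (res j) ⟨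
      pow R ω (negRes j ℕ.+ res j)           ≡⟨ ≡.cong (pow R ω) (ℕₚ.m∸n+n≡m (ℕₚ.<⇒≤ (ℕₚ.m%n<n (2 ^ j) r))) ⟩
      pow R ω r                              ≈⟨ proj₁ (proj₂ ω-order) ⟩
      1#                                     ∎

  private
    CompletesUnits : List ℕ → List ℕ → Set ℓ
    CompletesUnits ks zs = φ r ≡ length ks ℕ.+ length zs × ∏ f ks * ∏ f zs ≈ ι p

    split : ∀ {ks} → Unique ks → (∀ {k} → k ∈ ks → k ∈ units r) → ∃[ zs ] CompletesUnits ks zs
    split {ks} ks-unique ks⊆units with zs , units↭ks++zs ← unique-⊆⇒↭++ (units-unique r) ks-unique ks⊆units =
      zs , ≡.trans (↭-length units↭ks++zs) (Listₚ.length-++ ks) ,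
      trans (sym (∏-++ f ks zs)) (trans (sym (∏-↭ f units↭ks++zs)) ∏-units≈p)

    ∏-all : ∀ {ks} → Unique ks → (∀ {k} → k ∈ ks → k ∈ units r) → φ r ≡ length ks → ∏ f ks ≈ ι p
    ∏-all {ks} ks-unique ks⊆units φ≡ = no-cofactor (split ks-unique ks⊆units)
      where
      no-cofactor : ∃[ zs ] CompletesUnits ks zs → ∏ f ks ≈ ι p
      no-cofactor ([] , _ , ∏≈p) = trans (sym (*-identityʳ _)) ∏≈p
      no-cofactor (_ ∷ _ , φ≡ks+1+ , _) = ⊥-elim (ℕₚ.m+1+n≢m (length ks) (≡.trans (≡.sym φ≡ks+1+) φ≡))

    length-residues : length residues ≡ s₀
    length-residues = Listₚ.length-applyUpTo res s₀

  s₀≤φ : s₀ ≤ φ r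
  s₀≤φ = bound (split residues-unique residues-⊆-units)
    where
    bound : ∃[ zs ] CompletesUnits residues zs → s₀ ≤ φ r
    bound (_ , φ≡ , _) = ≡.subst (_≤ φ r) length-residues (≡.subst (length residues ≤_) (≡.sym φ≡) (ℕₚ.m≤m+n _ _))

  s₀≡φ⇒T≈p : s₀ ≡ φ r → T R (2 ^ s₀) ω ≈ fromℤ R (ℤ.+ p)
  s₀≡φ⇒T≈p s₀≡φ = begin
    T R (2 ^ s₀) ω      ≈⟨ T-2^≈tmProduct s₀ ω ⟩
    tmProduct ω s₀      ≈⟨ ∏-residues ⟨
    ∏ f residues        ≈⟨ ∏-all residues-unique residues-⊆-units (≡.trans (≡.sym s₀≡φ) (≡.sym length-residues)) ⟩
    ι p                 ∎

  private
    ℤ[ω]-f : ∀ k → ℤ[ω] (f k)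
    ℤ[ω]-f k = IntegerSpan.Span-+ R ℤ[ω]-1 (ℤ[ω]-neg (ℤ[ω]-pow k))

    [1-ω]∣tmProduct : ∀ s → [1-ω]∣ tmProduct ω (suc s)
    [1-ω]∣tmProduct s = ∏ (λ j → f (2 ^ j)) (applyUpTo suc s) ,
      ℤ[ω]-∏ (λ j → f (2 ^ j)) (λ j → ℤ[ω]-f (2 ^ j)) (applyUpTo suc s) ,
      *-congʳ (+-congˡ (-‿cong (*-identityʳ ω)))

    ι∣z∣≈±fromℤ : ∀ z → ∃[ ε ] ℤ[ω] ε × ε * ε ≈ 1# × ι ℤ.∣ z ∣ ≈ ε * fromℤ R z
    ι∣z∣≈±fromℤ (ℤ.+ n)    = 1# , ℤ[ω]-1 , *-identityʳ 1# , sym (*-identityˡ _)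
    ι∣z∣≈±fromℤ ℤ.-[1+ n ] = - 1# , ℤ[ω]-neg ℤ[ω]-1 , solve 0 (:- :1 :* :- :1 := :1) refl ,
                               solve 1 (λ x → x := :- :1 :* :- x) refl (ι (suc n))

  T∈ℤ⇒s₀≡φ : ∃[ z ] T R (2 ^ s₀) ω ≈ fromℤ R z → s₀ ≡ φ r
  T∈ℤ⇒s₀≡φ (z , T≈z) = ℕₚ.≤-antisym s₀≤φ (ℕₚ.≮⇒≥ s₀≮φ)
    where
    tmProduct≈z : tmProduct ω s₀ ≈ fromℤ R z
    tmProduct≈z = trans (sym (T-2^≈tmProduct s₀ ω)) T≈z
    s₀≮φ : ¬ s₀ ℕ.< φ r
    s₀≮φ s₀<φ = contradiction (split residues-unique residues-⊆-units) (ι∣z∣≈±fromℤ z)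
     where
     contradiction : ∃[ zs ] CompletesUnits residues zs → ∃[ ε ] ℤ[ω] ε × ε * ε ≈ 1# × ι ℤ.∣ z ∣ ≈ ε * fromℤ R z → ⊥
     contradiction ([] , φ≡ , _) _ = ℕₚ.<⇒≢ s₀<φ (≡.trans (≡.sym length-residues) (≡.trans (≡.sym (ℕₚ.+-identityʳ _)) (≡.sym φ≡)))
     contradiction (k ∷ zs , _ , ∏≈p) (ε , ε∈ , ε²≈1 , ι∣z∣≈εz) =
      ¬ι[p]≈ι[n]*[1-ω]*V ℤ.∣ z ∣ (ℤ[ω]-* ε∈ V∈) [1-ω]∣ι∣z∣ (begin
        ι p                                        ≈⟨ ∏≈p ⟨
        ∏ f residues * (f k * ∏ f zs)              ≈⟨ *-cong ∏-residues (*-congʳ (sym ([1-y]*geometric ω k))) ⟩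
        tmProduct ω s₀ * ((1# - ω) * G * ∏ f zs)   ≈⟨ *-cong tmProduct≈z (*-assoc _ _ _) ⟩
        fromℤ R z * ((1# - ω) * V)                 ≈⟨ *-congʳ (trans (sym (*-identityˡ _)) (*-congʳ (sym ε²≈1))) ⟩
        ε * ε * fromℤ R z * ((1# - ω) * V)          ≈⟨ solve 4 (λ e z l v → e :* e :* z :* (l :* v) := (e :* z) :* (l :* (e :* v))) refl ε (fromℤ R z) (1# - ω) V ⟩
        (ε * fromℤ R z) * ((1# - ω) * (ε * V))     ≈⟨ *-congʳ ι∣z∣≈εz ⟨
        ι ℤ.∣ z ∣ * ((1# - ω) * (ε * V))            ∎)
      where
      G V : Carrier
      G = geometric ω k
      V = G * ∏ f zs
      V∈ : ℤ[ω] V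
      V∈ = ℤ[ω]-* (ℤ[ω]-geometric ℤ[ω]-ω k) (ℤ[ω]-∏ f ℤ[ω]-f zs)
      [1-ω]∣ι∣z∣ : [1-ω]∣ ι ℤ.∣ z ∣
      [1-ω]∣ι∣z∣ = [1-ω]∣-cong (sym ι∣z∣≈εz) ([1-ω]∣-*ˡ ε∈ ([1-ω]∣-cong tmProduct≈z
        (≡.subst (λ s → [1-ω]∣ tmProduct ω s) (ℕₚ.suc-pred s₀ {{ℕ.>-nonZero (proj₁ s₀-order)}}) ([1-ω]∣tmProduct (ℕ.pred s₀)))))

  private
    ω^2^s₀≈ω : pow R ω (2 ^ s₀) ≈ ω
    ω^2^s₀≈ω with divides q 2^s₀∸1≡qr ← proj₁ (proj₂ s₀-order) = begin
      pow R ω (2 ^ s₀)                    ≡⟨ ≡.cong (pow R ω) (≡.sym (ℕₚ.m∸n+n≡m (ℕₚ.m^n>0 2 s₀))) ⟩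
      pow R ω ((2 ^ s₀ ∸ 1) ℕ.+ 1)        ≡⟨ ≡.cong (λ m → pow R ω (m ℕ.+ 1)) 2^s₀∸1≡qr ⟩
      pow R ω (q ℕ.* r ℕ.+ 1)             ≈⟨ pow-+ ω (q ℕ.* r) 1 ⟩
      pow R ω (q ℕ.* r) * (ω * 1#)        ≈⟨ *-cong (ω^[m*r]≈1 q) (*-identityʳ ω) ⟩
      1# * ω                              ≈⟨ *-identityˡ ω ⟩
      ω                                   ∎

    tmProduct-ω⁻¹ : ∀ s → tmProduct ω⁻¹ s * pow R ω (2 ^ s) ≈ pow R (- 1#) s * (ω * tmProduct ω s)
    tmProduct-ω⁻¹ zero    = refl
    tmProduct-ω⁻¹ (suc s) = begin
      tmProduct ω⁻¹ (suc s) * pow R ω (2 ^ s ℕ.+ (2 ^ s ℕ.+ 0))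
        ≈⟨ *-cong (tmProduct-suc ω⁻¹ s) (trans (pow-+ ω (2 ^ s) _) (*-congˡ (reflexive (≡.cong (pow R ω) (ℕₚ.+-identityʳ (2 ^ s)))))) ⟩
      (P⁻ * (1# - y′)) * (y * y)
        ≈⟨ solve 3 (λ P y′ y → (P :* (:1 :- y′)) :* (y :* y) := (P :* y) :* (y :- y′ :* y)) refl P⁻ y′ y ⟩
      (P⁻ * y) * (y - y′ * y)
        ≈⟨ *-cong (tmProduct-ω⁻¹ s) (+-congˡ (-‿cong (ω⁻¹^2^*ω^2^≈1 s))) ⟩
      (pow R (- 1#) s * (ω * P)) * (y - 1#)
        ≈⟨ solve 4 (λ u w P y → (u :* (w :* P)) :* (y :- :1) := (:- :1 :* u) :* (w :* (P :* (:1 :- y)))) refl (pow R (- 1#) s) ω P y ⟩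
      pow R (- 1#) (suc s) * (ω * (P * (1# - y)))
        ≈⟨ *-congˡ (*-congˡ (tmProduct-suc ω s)) ⟨
      pow R (- 1#) (suc s) * (ω * tmProduct ω (suc s)) ∎
      where
      P P⁻ y y′ : Carrier
      P  = tmProduct ω s
      P⁻ = tmProduct ω⁻¹ s
      y  = pow R ω (2 ^ s)
      y′ = pow R ω⁻¹ (2 ^ s)

  -- Since ω^(2^s₀) = ω, the factors 1 - ω^(-2^j) = -ω^(-2^j) (1 - ω^(2^j)) contribute (-1)^s₀.
  tmProduct-ω⁻¹≈- : s₀ % 2 ≡ 1 → tmProduct ω⁻¹ s₀ ≈ - tmProduct ω s₀
  tmProduct-ω⁻¹≈- odd = begin
    P⁻                                   ≈⟨ solve 3 (λ P w v → P := P :* (w :* v) :+ P :* (:1 :- w :* v)) refl P⁻ ω ω⁻¹ ⟩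
    P⁻ * (ω * ω⁻¹) + P⁻ * (1# - ω * ω⁻¹) ≈⟨ +-cong (trans (sym (*-assoc _ _ _)) (*-congʳ (*-congˡ (sym ω^2^s₀≈ω)))) (*-congˡ (+-congˡ (-‿cong ωω⁻¹≈1))) ⟩
    P⁻ * pow R ω (2 ^ s₀) * ω⁻¹ + P⁻ * (1# - 1#) ≈⟨ +-congʳ (*-congʳ (trans (tmProduct-ω⁻¹ s₀) (*-congʳ (pow-[-1]-odd s₀ odd)))) ⟩
    - 1# * (ω * P) * ω⁻¹ + P⁻ * (1# - 1#) ≈⟨ solve 4 (λ P Q w v → :- :1 :* (w :* P) :* v :+ Q :* (:1 :- :1) := :- (P :* (w :* v))) refl P P⁻ ω ω⁻¹ ⟩
    - (P * (ω * ω⁻¹))                    ≈⟨ -‿cong (trans (*-congˡ ωω⁻¹≈1) (*-identityʳ P)) ⟩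
    - P                                  ∎
    where
    P P⁻ : Carrier
    P  = tmProduct ω s₀
    P⁻ = tmProduct ω⁻¹ s₀
    ωω⁻¹≈1 : ω * ω⁻¹ ≈ 1#
    ωω⁻¹≈1 = trans (*-comm ω ω⁻¹) ω⁻¹*ω≈1

  tmProduct-ω²≈-p : 2 ℕ.* s₀ ≡ φ r → s₀ % 2 ≡ 1 → tmProduct ω s₀ * tmProduct ω s₀ ≈ - ι p
  tmProduct-ω²≈-p 2s₀≡φ odd = begin
    P * P                              ≈⟨ solve 1 (λ x → x :* x := :- (x :* :- x)) refl P ⟩
    - (P * - P)                        ≈⟨ -‿cong (*-congˡ (tmProduct-ω⁻¹≈- odd)) ⟨
    - (P * tmProduct ω⁻¹ s₀)           ≈⟨ -‿cong (*-cong ∏-residues ∏-negResidues) ⟨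
    - (∏ f residues * ∏ f negResidues) ≈⟨ -‿cong (∏-++ f residues negResidues) ⟨
    - ∏ f (residues ++ negResidues)    ≈⟨ -‿cong (∏-all (±residues-unique odd) ±residues-⊆-units φ≡) ⟩
    - ι p                              ∎
    where
    P : Carrier
    P = tmProduct ω s₀
    φ≡ : φ r ≡ length (residues ++ negResidues)
    φ≡ = ≡.trans (≡.sym 2s₀≡φ) (≡.sym (≡.trans (Listₚ.length-++ residues)
           (≡.cong₂ ℕ._+_ length-residues (≡.trans (Listₚ.length-applyUpTo negRes s₀) (≡.sym (ℕₚ.+-identityʳ s₀))))))

  T≈±i√p : 2 ℕ.* s₀ ≡ φ r → s₀ % 2 ≡ 1 → (i s : Carrier) → i * i ≈ - 1# → s * s ≈ fromℤ R (ℤ.+ p) →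
           (T R (2 ^ s₀) ω ≈ i * s × T R (2 ^ s₀) ω⁻¹ ≈ - (i * s)) ⊎
           (T R (2 ^ s₀) ω ≈ - (i * s) × T R (2 ^ s₀) ω⁻¹ ≈ i * s)
  T≈±i√p 2s₀≡φ odd i s i²≈-1 s²≈p = Sum.map
    (λ P≈is → trans (T-2^≈tmProduct s₀ ω) P≈is ,
              trans (T-2^≈tmProduct s₀ ω⁻¹) (trans (tmProduct-ω⁻¹≈- odd) (-‿cong P≈is)))
    (λ P≈-is → trans (T-2^≈tmProduct s₀ ω) P≈-is ,
               trans (T-2^≈tmProduct s₀ ω⁻¹) (trans (tmProduct-ω⁻¹≈- odd) (trans (-‿cong P≈-is) (-‿involutive (i * s)))))
    (x*x≈y*y⇒x≈±y no-zero-divisors P²≈[is]²)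
    where
    open RingProperties ring using (-‿involutive)
    P : Carrier
    P = tmProduct ω s₀
    P²≈[is]² : P * P ≈ (i * s) * (i * s)
    P²≈[is]² = begin
      P * P              ≈⟨ tmProduct-ω²≈-p 2s₀≡φ odd ⟩
      - ι p              ≈⟨ solve 1 (λ x → :- x := :- :1 :* x) refl (ι p) ⟩
      - 1# * ι p         ≈⟨ *-cong i²≈-1 s²≈p ⟨
      (i * i) * (s * s)  ≈⟨ solve 2 (λ i s → (i :* i) :* (s :* s) := (i :* s) :* (i :* s)) refl i s ⟩
      (i * s) * (i * s)  ∎

proposition3p4 : ∀ {c ℓ} (R : CommutativeRing c ℓ) →
    CharZero R → NoZeroDivisors R →
    (p α r₀ s₀ : ℕ) → Prime p → p ≢ 2 → 1 ℕ.≤ α → r₀ ≡ p ℕ.^ α →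
    (ω : CommutativeRing.Carrier R) → HasExactOrder R ω r₀ →
    IsMultOrderOf2Mod s₀ r₀ →
    (((∃[ z ] CommutativeRing._≈_ R (T R (2 ℕ.^ s₀) ω) (fromℤ R z)) ⇔ (s₀ ≡ φ r₀))
      × (s₀ ≡ φ r₀ → CommutativeRing._≈_ R (T R (2 ℕ.^ s₀) ω) (fromℤ R (+ p))))
    × (2 ℕ.* s₀ ≡ φ r₀ → s₀ ℕ.% 2 ≡ 1 →
       (i s : CommutativeRing.Carrier R) →
       CommutativeRing._≈_ R (CommutativeRing._*_ R i i) (CommutativeRing.-_ R (CommutativeRing.1# R)) →
       CommutativeRing._≈_ R (CommutativeRing._*_ R s s) (fromℤ R (+ p)) →
       (CommutativeRing._≈_ R (T R (2 ℕ.^ s₀) ω) (CommutativeRing._*_ R i s)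
          × CommutativeRing._≈_ R (T R (2 ℕ.^ s₀) (pow R ω (r₀ ℕ.∸ 1)))
              (CommutativeRing.-_ R (CommutativeRing._*_ R i s)))
       ⊎ (CommutativeRing._≈_ R (T R (2 ℕ.^ s₀) ω) (CommutativeRing.-_ R (CommutativeRing._*_ R i s))
          × CommutativeRing._≈_ R (T R (2 ℕ.^ s₀) (pow R ω (r₀ ℕ.∸ 1)))
              (CommutativeRing._*_ R i s)))
proposition3p4 R char-zero no-zero-divisors p (suc α) _ s₀ p-prime p≢2 (s≤s z≤n) ≡.refl ω ω-order s₀-order =
  (mk⇔ T∈ℤ⇒s₀≡φ (λ s₀≡φ → + p , s₀≡φ⇒T≈p s₀≡φ) , s₀≡φ⇒T≈p) , T≈±i√p
  where open ThueMorseAtPrimePowerRoots R char-zero no-zero-divisors p-prime p≢2 α s₀ ω ω-order s₀-order
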